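{- Let $p$ be an odd prime and $G=\langle x\rangle\rtimes\langle y\rangle$ the extraspecial group of order $p^3$ and exponent $p^2$, where $|x|=p^2$, $|y|=p$, $yxy^{ -1}=xz$ with $z=x^p$. Put $Y=\langle y\rangle$ and $Z=\langle z\rangle$. Let $\xi$ be the $p$-th power of a primitive root modulo $p^2$, and for an integer $\alpha$ let $\eta(\alpha)\in\mathbb{Z}_p$ be its residue modulo $p$. Let $$X_0=\{x^\alpha y^\beta z^{\eta(\alpha)\beta/2}:\ \alpha\in\{\xi^0,\xi^1,\ldots,\xi^{p-2}\},\ \beta\in\{0,\ldots,p-1\}\},$$ where the exponent $\eta(\alpha)\beta/2$ is computed in $\mathbb{Z}_p$, and for $i\in\{0,\ldots,p-1\}$ let $X_i=X_0y^i$. Then for every $i\in\{0,\ldots,p-1\}$, the sets $Y_i=X_i\cup Y$ and $Z_i=X_i\cup Z$ are semiregular reversible relative difference sets with parameters $(p^2,p,p^2,p)$ and forbidden subgroups $Z$ and $Y$, respectively.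
   Context: For $X\subseteq G$, $\underline{X}=\sum_{x\in X}x\in\mathbb{Z}G$, $X^{(-1)}=\{x^{ -1}:x\in X\}$, $e$ the identity. For $N\leq G$ (not necessarily normal), $X$ is a relative difference set relative to $N$ with parameters $(m,n,k,\lambda)$ if $\underline{X}\cdot\underline{X^{(-1)}}=ke+\lambda(\underline{G}-\underline{N})$, $k=|X|$, $m=|G:N|$, $n=|N|$, $\lambda>0$. Semiregular: $|X\cap Ng|=1$ for all $g\in G$. Reversible: $X=X^{(-1)}$. -}

module Defs where

open import Data.Nat.Base
open import Data.Nat.Properties using (m*n≢0)
open import Data.Bool.Base using (Bool; true; false; _∧_; _∨_; if_then_else_)
open import Data.List.Base using (List; map; concatMap; upTo; length)
open import Data.Nat.ListAction using (sum)
open import Data.Bool.ListAction using (any)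
open import Data.Product.Base using (_×_; _,_; proj₁; proj₂)
open import Relation.Binary.PropositionalEquality using (_≡_; _≢_)

module _ (p : ℕ) .{{_ : NonZero p}} where

  p² : ℕ
  p² = p * p

  private instance
    nz² : NonZero p²
    nz² = m*n≢0 p p

  -- The extraspecial group G = ⟨x⟩ ⋊ ⟨y⟩ of order p³ and exponent p²:
  -- the pair (a , b) with a < p², b < p stands for x^a y^b.
  -- From y x y⁻¹ = x z = x^(1+p) we get y^b x^c = x^(c (1+p)^b) y^b.
  G : Set
  G = ℕ × ℕ

  Valid : G → Set
  Valid (a , b) = (a < p²) × (b < p)

  elems : List G
  elems = concatMap (λ a → map (λ b → (a , b)) (upTo p)) (upTo p²)

  e : G
  e = (0 , 0)

  mul : G → G → G
  mul (a , b) (c , d) = ((a + c * (1 + p) ^ b) % p² , (b + d) % p)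

  -- (x^a y^b)⁻¹ = y^(-b) x^(-a) = x^(-a (1+p)^(p-b)) y^(p-b)
  inv : G → G
  inv (a , b) = (((p² ∸ a) * (1 + p) ^ (p ∸ b)) % p² , (p ∸ b) % p)

  pow : G → ℕ → G
  pow g zero = e
  pow g (suc n) = mul (pow g n) g

  _==_ : G → G → Bool
  (a , b) == (c , d) = (a ≡ᵇ c) ∧ (b ≡ᵇ d)

  gx gy gz : G
  gx = (1 , 0)
  gy = (0 , 1)
  gz = pow gx p

  Subset : Set
  Subset = G → Bool

  ind : Bool → ℕ
  ind true = 1
  ind false = 0

  card : Subset → ℕ
  card S = sum (map (λ g → ind (S g)) elems)

  cyc : G → Subset
  cyc g h = any (λ j → pow g j == h) (upTo (length elems))

  Ysub Zsub : Subset
  Ysub = cyc gy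
  Zsub = cyc gz

  -- coefficient of g in  S · S^(-1)  (group ring product):
  -- #{ (u , v) ∈ S × S : u v⁻¹ = g }
  coeff : Subset → G → ℕ
  coeff S g = sum (map (λ u → sum (map (λ v → ind (S u ∧ S v ∧ (mul u (inv v) == g))) elems)) elems)

  -- S is a relative difference set relative to N with parameters (m,n,k,λ):
  -- S · S^(-1) = k e + λ (G − N), m = |G:N|, n = |N|, k = |S|, λ > 0.
  record IsRDS (S N : Subset) (m n k l : ℕ) : Set where
    field
      index   : m * card N ≡ card (λ _ → true)
      sizeN   : n ≡ card N
      sizeS   : k ≡ card S
      l-pos   : 0 < l
      product : ∀ g → Valid g →
                coeff S g ≡ (if g == e then k else 0) + (if N g then 0 else l)

  Semiregular : Subset → Subset → Set
  Semiregular S N = ∀ g → Valid g → card (λ h → S h ∧ N (mul h (inv g))) ≡ 1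

  Reversible : Subset → Set
  Reversible S = ∀ g → Valid g → S g ≡ S (inv g)

  SemiregularReversibleRDS : (S N : Subset) (m n k l : ℕ) → Set
  SemiregularReversibleRDS S N m n k l =
    IsRDS S N m n k l × Semiregular S N × Reversible S

  IsPrimitiveRootModp² : ℕ → Set
  IsPrimitiveRootModp² r =
    ((r ^ (p * (p ∸ 1))) % p² ≡ 1) ×
    (∀ k → 0 < k → k < p * (p ∸ 1) → (r ^ k) % p² ≢ 1)

  -- η(α) = α mod p ;  t/2 in ℤ_p is t · 2⁻¹ with 2⁻¹ = (p+1)/2 (p odd)
  η : ℕ → ℕ
  η α = α % p

  half : ℕ → ℕ
  half t = (t * ((p + 1) / 2)) % p

  module _ (r : ℕ) where
    ξ : ℕ
    ξ = r ^ p

    -- α ∈ {ξ^0, …, ξ^(p-2)}  (taken modulo p², which does not change x^α or η(α))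
    alphas : List ℕ
    alphas = map (λ j → (ξ ^ j) % p²) (upTo (p ∸ 1))

    X0list : List G
    X0list = concatMap (λ α → map (λ β →
               mul (mul (pow gx α) (pow gy β)) (pow gz (half (η α * β))))
               (upTo p)) alphas

    Xi : ℕ → Subset
    Xi i g = any (λ u → mul u (pow gy i) == g) X0list

    Yi Zi : ℕ → Subset
    Yi i g = Xi i g ∨ Ysub g
    Zi i g = Xi i g ∨ Zsub g

{-# OPTIONS --safe #-}
module Submission where

open import Data.Nat.Base using (ℕ; NonZero)
import Data.Nat.Divisibility as ℕ
open import Data.Nat.Primality using (Prime)
open import Data.Integer.Base using (ℤ)
open import Relation.Nullary using (¬_)
open import Defs

module FiniteSums where

  open import Data.Nat.Base
  open import Data.Nat.Properties
  open import Algebra.Properties.CommutativeSemigroup +-commutativeSemigroup using (interchange)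
  open import Data.List.Base using (applyUpTo)
  open import Data.Nat.ListAction using (sum)
  open import Data.Product.Base using (_×_; _,_; ∃-syntax)
  open import Function.Base using (_∘_)
  open import Relation.Binary.PropositionalEquality

  ∑ : ℕ → (ℕ → ℕ) → ℕ
  ∑ n f = sum (applyUpTo f n)

  syntax ∑ n (λ k → e) = ∑[ k < n ] e

  AtMostOnePositive : ℕ → (ℕ → ℕ) → Set
  AtMostOnePositive n f = ∀ k k′ → k < n → k′ < n → 0 < f k → 0 < f k′ → k ≡ k′

  ∑-cong : ∀ n {f g : ℕ → ℕ} → (∀ k → k < n → f k ≡ g k) → ∑ n f ≡ ∑ n g
  ∑-cong zero    f≡g = refl
  ∑-cong (suc n) f≡g = cong₂ _+_ (f≡g 0 z<s) (∑-cong n (λ k k<n → f≡g (suc k) (s<s k<n)))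

  ∑-mono-≤ : ∀ n {f g : ℕ → ℕ} → (∀ k → k < n → f k ≤ g k) → ∑ n f ≤ ∑ n g
  ∑-mono-≤ zero    f≤g = z≤n
  ∑-mono-≤ (suc n) f≤g = +-mono-≤ (f≤g 0 z<s) (∑-mono-≤ n (λ k k<n → f≤g (suc k) (s<s k<n)))

  ∑-const : ∀ n c → ∑[ _ < n ] c ≡ n * c
  ∑-const zero    c = refl
  ∑-const (suc n) c = cong (c +_) (∑-const n c)

  ∑-zero : ∀ n {f : ℕ → ℕ} → (∀ k → k < n → f k ≡ 0) → ∑ n f ≡ 0
  ∑-zero n f≡0 = trans (∑-cong n f≡0) (trans (∑-const n 0) (*-zeroʳ n))

  ∑-≤-count : ∀ n {f : ℕ → ℕ} → (∀ k → k < n → f k ≤ 1) → ∑ n f ≤ n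
  ∑-≤-count n f≤1 = ≤-trans (∑-mono-≤ n f≤1) (≤-reflexive (trans (∑-const n 1) (*-identityʳ n)))

  ∑-distrib-+ : ∀ n (f g : ℕ → ℕ) → ∑[ k < n ] (f k + g k) ≡ ∑ n f + ∑ n g
  ∑-distrib-+ zero    f g = refl
  ∑-distrib-+ (suc n) f g = trans (cong ((f 0 + g 0) +_) (∑-distrib-+ n (f ∘ suc) (g ∘ suc)))
                                  (interchange (f 0) (g 0) _ _)

  ∑-distribˡ-* : ∀ n c (f : ℕ → ℕ) → ∑[ k < n ] (c * f k) ≡ c * ∑ n f
  ∑-distribˡ-* zero    c f = sym (*-zeroʳ c)
  ∑-distribˡ-* (suc n) c f = trans (cong (c * f 0 +_) (∑-distribˡ-* n c (f ∘ suc)))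
                                   (sym (*-distribˡ-+ c (f 0) _))

  ∑-distribʳ-* : ∀ n c (f : ℕ → ℕ) → ∑[ k < n ] (f k * c) ≡ ∑ n f * c
  ∑-distribʳ-* n c f = trans (∑-cong n (λ k _ → *-comm (f k) c)) (trans (∑-distribˡ-* n c f) (*-comm c _))

  ∑-comm : ∀ m n (f : ℕ → ℕ → ℕ) → ∑[ a < m ] ∑[ b < n ] f a b ≡ ∑[ b < n ] ∑[ a < m ] f a b
  ∑-comm zero    n f = sym (∑-zero n (λ _ _ → refl))
  ∑-comm (suc m) n f = trans (cong (∑ n (f 0) +_) (∑-comm m n (f ∘ suc)))
                             (sym (∑-distrib-+ n (f 0) (λ b → ∑[ a < m ] f (suc a) b)))

  ∑-single : ∀ n {f : ℕ → ℕ} k₀ → k₀ < n → (∀ k → k < n → k ≢ k₀ → f k ≡ 0) → ∑ n f ≡ f k₀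
  ∑-single (suc n) {f} zero _ others =
    trans (cong (f 0 +_) (∑-zero n (λ k k<n → others (suc k) (s<s k<n) (λ ())))) (+-identityʳ _)
  ∑-single (suc n) {f} (suc k₀) k₀<n others =
    trans (cong (_+ ∑ n (f ∘ suc)) (others 0 z<s (λ ())))
          (∑-single n k₀ (s<s⁻¹ k₀<n) (λ k k<n k≢k₀ → others (suc k) (s<s k<n) (k≢k₀ ∘ suc-injective)))

  term≤∑ : ∀ n (f : ℕ → ℕ) k → k < n → f k ≤ ∑ n f
  term≤∑ (suc n) f zero    _   = m≤m+n (f 0) _
  term≤∑ (suc n) f (suc k) k<n = ≤-trans (term≤∑ n (f ∘ suc) k (s<s⁻¹ k<n)) (m≤n+m _ (f 0))

  ∑-pos⇒∃ : ∀ n (f : ℕ → ℕ) → 0 < ∑ n f → ∃[ k ] (k < n × 0 < f k)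
  ∑-pos⇒∃ (suc n) f pos with f 0 in f0≡
  ... | suc _ = 0 , z<s , subst (0 <_) (sym f0≡) z<s
  ... | zero  with ∑-pos⇒∃ n (f ∘ suc) pos
  ...   | k , k<n , fk>0 = suc k , s<s k<n , fk>0

  ∑-≤-atMostOnePositive : ∀ n (f : ℕ → ℕ) c → (∀ k → k < n → f k ≤ c) → AtMostOnePositive n f → ∑ n f ≤ c
  ∑-≤-atMostOnePositive n f c f≤c unique with ∑ n f in ∑≡
  ... | zero  = z≤n
  ... | suc _ with ∑-pos⇒∃ n f (subst (0 <_) (sym ∑≡) z<s)
  ...   | k₀ , k₀<n , fk₀>0 = subst (_≤ c) (trans (sym (∑-single n k₀ k₀<n others)) ∑≡) (f≤c k₀ k₀<n)
    where
    others : ∀ k → k < n → k ≢ k₀ → f k ≡ 0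
    others k k<n k≢k₀ with f k in fk≡
    ... | zero  = refl
    ... | suc _ = ⊥-elim (k≢k₀ (unique k k₀ k<n k₀<n (subst (0 <_) (sym fk≡) z<s) fk₀>0))
      where open import Data.Empty using (⊥-elim)

  ∑-squeeze : ∀ n (f g : ℕ → ℕ) → (∀ k → k < n → f k ≤ g k) → ∑ n g ≤ ∑ n f → ∀ k → k < n → f k ≡ g k
  ∑-squeeze (suc n) f g f≤g ∑g≤∑f zero _ = ≤-antisym (f≤g 0 z<s)
    (+-cancelʳ-≤ (∑ n (g ∘ suc)) (g 0) (f 0)
      (≤-trans ∑g≤∑f (+-monoʳ-≤ (f 0) (∑-mono-≤ n (λ k k<n → f≤g (suc k) (s<s k<n))))))
  ∑-squeeze (suc n) f g f≤g ∑g≤∑f (suc k) k<n = ∑-squeeze n (f ∘ suc) (g ∘ suc)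
    (λ k k<n → f≤g (suc k) (s<s k<n))
    (+-cancelˡ-≤ (g 0) _ _ (≤-trans ∑g≤∑f (+-monoˡ-≤ (∑ n (f ∘ suc)) (f≤g 0 z<s)))) k (s<s⁻¹ k<n)

module Congruence where

  open import Data.Nat.Base as ℕ using (ℕ; zero; suc; NonZero; _%_; _/_; _^_)
  import Data.Nat.Properties as ℕ
  import Data.Nat.DivMod as ℕ
  import Data.Nat.Divisibility as ℕ
  open import Data.Nat.Primality using (Prime; euclidsLemma)
  open import Data.Integer.Base hiding (NonZero; _%_; _/_; _^_)
  open import Data.Integer.Properties
  open import Data.Integer.DivMod using (a≡a%ℕn+[a/ℕn]*n)
  open import Data.Integer.Divisibility.Signed
  open import Data.Integer.Tactic.RingSolver using (solve-∀)
  open import Data.Sum.Base using (_⊎_; inj₁; inj₂; map)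
  open import Function.Base using (_∘_)
  open import Relation.Binary.Bundles using (Setoid)
  open import Relation.Binary.PropositionalEquality
  open import Relation.Nullary using (contradiction)

  infix 4 _≡_mod_

  record _≡_mod_ (a b m : ℤ) : Set where
    constructor ≡-mod
    field ∣-difference : m ∣ a - b
  open _≡_mod_ public

  module _ {m : ℤ} where

    ≡-mod-reflexive : ∀ {a b} → a ≡ b → a ≡ b mod m
    ≡-mod-reflexive {a} refl = ≡-mod (divides 0ℤ (+-inverseʳ a))

    ≡-mod-refl : ∀ {a} → a ≡ a mod m
    ≡-mod-refl = ≡-mod-reflexive refl

    ≡-mod-sym : ∀ {a b} → a ≡ b mod m → b ≡ a mod m
    ≡-mod-sym {a} {b} (≡-mod m∣a-b) = ≡-mod (subst (m ∣_) (identity a b) (∣m⇒∣-m m∣a-b))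
      where identity : ∀ a b → - (a - b) ≡ b - a
            identity = solve-∀

    ≡-mod-trans : ∀ {a b c} → a ≡ b mod m → b ≡ c mod m → a ≡ c mod m
    ≡-mod-trans {a} {b} {c} (≡-mod m∣a-b) (≡-mod m∣b-c) = ≡-mod (subst (m ∣_) (identity a b c) (∣m∣n⇒∣m+n m∣a-b m∣b-c))
      where identity : ∀ a b c → (a - b) + (b - c) ≡ a - c
            identity = solve-∀

    ≡-mod-setoid : Setoid _ _
    ≡-mod-setoid = record
      { Carrier = ℤ ; _≈_ = λ a b → a ≡ b mod m
      ; isEquivalence = record { refl = ≡-mod-refl ; sym = ≡-mod-sym ; trans = ≡-mod-trans } }

    ≡-mod-+ : ∀ {a b c d} → a ≡ b mod m → c ≡ d mod m → a + c ≡ b + d mod m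
    ≡-mod-+ {a} {b} {c} {d} (≡-mod m∣a-b) (≡-mod m∣c-d) = ≡-mod (subst (m ∣_) (identity a b c d) (∣m∣n⇒∣m+n m∣a-b m∣c-d))
      where identity : ∀ a b c d → (a - b) + (c - d) ≡ (a + c) - (b + d)
            identity = solve-∀

    ≡-mod-* : ∀ {a b c d} → a ≡ b mod m → c ≡ d mod m → a * c ≡ b * d mod m
    ≡-mod-* {a} {b} {c} {d} (≡-mod m∣a-b) (≡-mod m∣c-d) =
      ≡-mod (subst (m ∣_) (identity a b c d) (∣m∣n⇒∣m+n (∣m⇒∣m*n c m∣a-b) (∣n⇒∣m*n b m∣c-d)))
      where identity : ∀ a b c d → (a - b) * c + b * (c - d) ≡ a * c - b * d
            identity = solve-∀

    ≡-mod-neg : ∀ {a b} → a ≡ b mod m → - a ≡ - b mod m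
    ≡-mod-neg {a} {b} (≡-mod m∣a-b) = ≡-mod (subst (m ∣_) (identity a b) (∣m⇒∣-m m∣a-b))
      where identity : ∀ a b → - (a - b) ≡ (- a) - (- b)
            identity = solve-∀

    ≡-mod-^ : ∀ {a b} n → + a ≡ + b mod m → + (a ^ n) ≡ + (b ^ n) mod m
    ≡-mod-^ {a} {b} zero    a≡b = ≡-mod-refl
    ≡-mod-^ {a} {b} (suc n) a≡b = ≡-mod-trans (≡-mod-reflexive (pos-* a (a ^ n)))
      (≡-mod-trans (≡-mod-* a≡b (≡-mod-^ n a≡b)) (≡-mod-reflexive (sym (pos-* b (b ^ n)))))

    ≡-mod-multiple : ∀ {a b} k → a ≡ b + k * m → a ≡ b mod m
    ≡-mod-multiple {a} {b} k a≡b+km = ≡-mod (divides k (trans (cong (_- b) a≡b+km) (identity b k m)))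
      where identity : ∀ b k m → b + k * m - b ≡ k * m
            identity = solve-∀

    ∣⇒≡0-mod : ∀ {a} → m ∣ a → a ≡ 0ℤ mod m
    ∣⇒≡0-mod {a} m∣a = ≡-mod (subst (m ∣_) (sym (+-identityʳ a)) m∣a)

    ≡0-mod⇒∣ : ∀ {a} → a ≡ 0ℤ mod m → m ∣ a
    ≡0-mod⇒∣ {a} (≡-mod m∣a-0) = subst (m ∣_) (+-identityʳ a) m∣a-0

    ≡-mod-∣ : ∀ {a b} → a ≡ b mod m → m ∣ a → m ∣ b
    ≡-mod-∣ {a} {b} (≡-mod m∣a-b) m∣a = subst (m ∣_) (identity a b) (∣m∣n⇒∣m-n m∣a m∣a-b)
      where identity : ∀ a b → a - (a - b) ≡ b
            identity = solve-∀

  ≡-mod-weaken : ∀ {m n a b} → a ≡ b mod m * n → a ≡ b mod m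
  ≡-mod-weaken {m} {n} (≡-mod mn∣a-b) = ≡-mod (∣-trans (∣m⇒∣m*n n ∣-refl) mn∣a-b)

  ≡-mod-scale : ∀ {m a b} k → a ≡ b mod m → k * a ≡ k * b mod k * m
  ≡-mod-scale {m} {a} {b} k (≡-mod m∣a-b) =
    ≡-mod (subst (k * m ∣_) (identity k a b) (*-monoʳ-∣ k m∣a-b))
    where identity : ∀ k a b → k * (a - b) ≡ k * a - k * b
          identity = solve-∀

  %-≡-mod : ∀ x n .{{_ : NonZero n}} → + (x % n) ≡ + x mod + n
  %-≡-mod x n = ≡-mod-sym (≡-mod-multiple (+ (x / n)) (begin
    + x                       ≡⟨ cong +_ (ℕ.m≡m%n+[m/n]*n x n) ⟩
    + (x % n ℕ.+ x / n ℕ.* n) ≡⟨ pos-+ (x % n) _ ⟩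
    + (x % n) + + (x / n ℕ.* n) ≡⟨ cong (_+_ (+ (x % n))) (pos-* (x / n) n) ⟩
    + (x % n) + + (x / n) * + n ∎))
    where open ≡-Reasoning

  %ℕ-≡-mod : ∀ a n .{{_ : NonZero n}} → + (a %ℕ n) ≡ a mod + n
  %ℕ-≡-mod a n = ≡-mod-sym (≡-mod-multiple (a /ℕ n) (a≡a%ℕn+[a/ℕn]*n a n))

  private
    multiple<⇒≡0 : ∀ {n d} → d ℕ.< n → n ℕ.∣ d → d ≡ 0
    multiple<⇒≡0 {d = zero}  _   _   = refl
    multiple<⇒≡0 {d = suc d} d<n n∣d = contradiction n∣d (ℕ.>⇒∤ d<n)

    ≡-mod⇒≡-≥ : ∀ {x y n} → y ℕ.≤ x → x ℕ.< n → + x ≡ + y mod + n → x ≡ y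
    ≡-mod⇒≡-≥ {x} {y} {n} y≤x x<n (≡-mod n∣x-y) =
      ℕ.≤-antisym (ℕ.m∸n≡0⇒m≤n (multiple<⇒≡0 (ℕ.≤-<-trans (ℕ.m∸n≤m x y) x<n) n∣x∸y)) y≤x
      where n∣x∸y : n ℕ.∣ x ℕ.∸ y
            n∣x∸y = subst (n ℕ.∣_) (cong ∣_∣ (trans (m-n≡m⊖n x y) (⊖-≥ y≤x))) (∣⇒∣ᵤ n∣x-y)

  ≡-mod⇒≡ : ∀ {x y n} → x ℕ.< n → y ℕ.< n → + x ≡ + y mod + n → x ≡ y
  ≡-mod⇒≡ {x} {y} x<n y<n x≡y with ℕ.≤-total y x
  ... | inj₁ y≤x = ≡-mod⇒≡-≥ y≤x x<n x≡y
  ... | inj₂ x≤y = sym (≡-mod⇒≡-≥ x≤y y<n (≡-mod-sym x≡y))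

  euclidsLemmaℤ : ∀ {p} a b → Prime p → (+ p) ∣ a * b → ((+ p) ∣ a) ⊎ ((+ p) ∣ b)
  euclidsLemmaℤ {p} a b p-prime p∣ab =
    map ∣ᵤ⇒∣ ∣ᵤ⇒∣ (euclidsLemma ∣ a ∣ ∣ b ∣ p-prime (subst (p ℕ.∣_) (abs-* a b) (∣⇒∣ᵤ p∣ab)))

  ∣-lincomb₂ : ∀ {m x y} z k₁ k₂ → m ∣ x → m ∣ y → z ≡ k₁ * x + k₂ * y → m ∣ z
  ∣-lincomb₂ z k₁ k₂ m∣x m∣y z≡ = subst (_ ∣_) (sym z≡) (∣m∣n⇒∣m+n (∣n⇒∣m*n k₁ m∣x) (∣n⇒∣m*n k₂ m∣y))

  ∣-lincomb₃ : ∀ {m x y w} z k₁ k₂ k₃ → m ∣ x → m ∣ y → m ∣ w → z ≡ k₁ * x + k₂ * y + k₃ * w → m ∣ z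
  ∣-lincomb₃ z k₁ k₂ k₃ m∣x m∣y m∣w z≡ =
    subst (_ ∣_) (sym z≡) (∣m∣n⇒∣m+n (∣m∣n⇒∣m+n (∣n⇒∣m*n k₁ m∣x) (∣n⇒∣m*n k₂ m∣y)) (∣n⇒∣m*n k₃ m∣w))

module GroupArithmetic where

  open import Data.Nat.Base as ℕ using (ℕ; zero; suc; NonZero; _%_; _≡ᵇ_)
  import Data.Nat.Properties as ℕ
  import Data.Nat.DivMod as ℕ
  open import Data.Integer.Base hiding (NonZero; _%_)
  open import Data.Integer.Properties
  open import Data.Integer.Divisibility.Signed using (_∣_; ∣-trans; ∣m⇒∣m*n; ∣-refl)
  open import Data.Integer.Tactic.RingSolver using (solve-∀)
  open import Data.Bool.Base using (T)
  open import Data.Bool.Properties using (T-∧)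
  open import Data.Product.Base using (_,_; proj₁; proj₂)
  open import Function.Bundles using (Equivalence)
  open import Relation.Binary.PropositionalEquality
  open import Defs
  open Congruence

  module Arithmetic (p : ℕ) .{{_ : NonZero p}} where

    instance
      p²-nonZero : NonZero (p ℕ.* p)
      p²-nonZero = ℕ.m*n≢0 p p

    P P² : ℤ
    P  = + p
    P² = P * P

    %p²≡ : ∀ x → + (x % (p ℕ.* p)) ≡ + x mod P²
    %p²≡ x = subst (+ (x % (p ℕ.* p)) ≡ + x mod_) (pos-* p p) (%-≡-mod x (p ℕ.* p))

    %p≡ : ∀ x → + (x % p) ≡ + x mod P
    %p≡ x = %-≡-mod x p

    ≡-mod-P²⇒≡ : ∀ {x y} → x ℕ.< p ℕ.* p → y ℕ.< p ℕ.* p → + x ≡ + y mod P² → x ≡ y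
    ≡-mod-P²⇒≡ {x} {y} x<p² y<p² x≡y = ≡-mod⇒≡ x<p² y<p² (subst (+ x ≡ + y mod_) (sym (pos-* p p)) x≡y)

    ≡-mod-P²⇒P : ∀ {a b} → a ≡ b mod P² → a ≡ b mod P
    ≡-mod-P²⇒P = ≡-mod-weaken

    P²∣⇒P∣ : ∀ {a} → P² ∣ a → P ∣ a
    P²∣⇒P∣ = ∣-trans (∣m⇒∣m*n P ∣-refl)

    [1+p]^k≡1+kp : ∀ k → + ((1 ℕ.+ p) ℕ.^ k) ≡ 1ℤ + + k * P mod P²
    [1+p]^k≡1+kp zero    = ≡-mod-reflexive (identity P)
      where identity : ∀ x → 1ℤ ≡ 1ℤ + 0ℤ * x
            identity = solve-∀
    [1+p]^k≡1+kp (suc k) = ≡-mod-trans (≡-mod-reflexive (pos-* (1 ℕ.+ p) _))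
      (≡-mod-trans (≡-mod-* (≡-mod-refl {a = + (1 ℕ.+ p)}) ([1+p]^k≡1+kp k))
        (≡-mod-multiple (+ k) (trans (cong (_* (1ℤ + + k * P)) (pos-+ 1 p)) (identity (+ k) P))))
      where identity : ∀ k x → (1ℤ + x) * (1ℤ + k * x) ≡ (1ℤ + (1ℤ + k) * x) + k * (x * x)
            identity = solve-∀

    *P-≡-mod : ∀ {a b} → a ≡ b mod P → a * P ≡ b * P mod P²
    *P-≡-mod {a} {b} a≡b = subst₂ (_≡_mod P²) (*-comm P a) (*-comm P b) (≡-mod-scale P a≡b)

    record Coords (g : G p) (A B : ℤ) : Set where
      constructor coords
      field
        first  : + proj₁ g ≡ A mod P²
        second : + proj₂ g ≡ B mod P
    open Coords public

    coords-self : ∀ g → Coords g (+ proj₁ g) (+ proj₂ g)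
    coords-self g = coords ≡-mod-refl ≡-mod-refl

    coords-cong : ∀ {g A B A′ B′} → Coords g A B → A ≡ A′ mod P² → B ≡ B′ mod P → Coords g A′ B′
    coords-cong (coords gA gB) A≡A′ B≡B′ = coords (≡-mod-trans gA A≡A′) (≡-mod-trans gB B≡B′)

    coords-injective : ∀ {g h A B} → Valid p g → Valid p h → Coords g A B → Coords h A B → g ≡ h
    coords-injective {a , b} {c , d} (a<p² , b<p) (c<p² , d<p) (coords aA bB) (coords cA dB) =
      cong₂ _,_ (≡-mod-P²⇒≡ a<p² c<p² (≡-mod-trans aA (≡-mod-sym cA)))
                (≡-mod⇒≡ b<p d<p (≡-mod-trans bB (≡-mod-sym dB)))

    mul-valid : ∀ g h → Valid p (mul p g h)
    mul-valid _ _ = ℕ.m%n<n _ (p ℕ.* p) , ℕ.m%n<n _ p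

    inv-valid : ∀ g → Valid p (inv p g)
    inv-valid _ = ℕ.m%n<n _ (p ℕ.* p) , ℕ.m%n<n _ p

    coords-mul : ∀ {g h A B C D} → Coords g A B → Coords h C D →
                 Coords (mul p g h) (A + C * (1ℤ + B * P)) (B + D)
    coords-mul {a , b} {c , d} {A} {B} {C} {D} (coords aA bB) (coords cC dD) = coords first′ second′
      where
      open import Relation.Binary.Reasoning.Setoid (≡-mod-setoid {P²})
      first′ = begin
        + ((a ℕ.+ c ℕ.* (1 ℕ.+ p) ℕ.^ b) % (p ℕ.* p))  ≈⟨ %p²≡ _ ⟩
        + (a ℕ.+ c ℕ.* (1 ℕ.+ p) ℕ.^ b)               ≡⟨ trans (pos-+ a _) (cong (_+_ (+ a)) (pos-* c _)) ⟩
        + a + + c * + ((1 ℕ.+ p) ℕ.^ b)               ≈⟨ ≡-mod-+ aA (≡-mod-* cC ([1+p]^k≡1+kp b)) ⟩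
        A + C * (1ℤ + + b * P)                         ≈⟨ ≡-mod-+ (≡-mod-refl {a = A}) (≡-mod-* (≡-mod-refl {a = C}) (≡-mod-+ (≡-mod-refl {a = 1ℤ}) (*P-≡-mod bB))) ⟩
        A + C * (1ℤ + B * P)                           ∎
      second′ = ≡-mod-trans (%p≡ _) (≡-mod-trans (≡-mod-reflexive (pos-+ b d)) (≡-mod-+ bB dD))

    ∸≡- : ∀ {m n} → n ℕ.≤ m → + (m ℕ.∸ n) ≡ + m - + n
    ∸≡- {m} {n} n≤m = trans (sym (⊖-≥ n≤m)) (sym (m-n≡m⊖n m n))

    coords-inv : ∀ {g A B} → Valid p g → Coords g A B → Coords (inv p g) (- A * (1ℤ - B * P)) (- B)
    coords-inv {a , b} {A} {B} (a<p² , b<p) (coords aA bB) = coords first′ second′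
      where
      -x≡x-m : ∀ {m x X} → x ≡ X mod m → m - x ≡ - X mod m
      -x≡x-m {m} {x} x≡X = ≡-mod-trans (≡-mod-multiple 1ℤ (identity m x)) (≡-mod-neg x≡X)
        where identity : ∀ m x → m - x ≡ - x + 1ℤ * m
              identity = solve-∀
      p∸b≡-B : + (p ℕ.∸ b) ≡ - B mod P
      p∸b≡-B = ≡-mod-trans (≡-mod-reflexive (∸≡- (ℕ.<⇒≤ b<p))) (-x≡x-m bB)
      open import Relation.Binary.Reasoning.Setoid (≡-mod-setoid {P²})
      first′ = begin
        + (((p ℕ.* p ℕ.∸ a) ℕ.* (1 ℕ.+ p) ℕ.^ (p ℕ.∸ b)) % (p ℕ.* p))  ≈⟨ %p²≡ _ ⟩
        + ((p ℕ.* p ℕ.∸ a) ℕ.* (1 ℕ.+ p) ℕ.^ (p ℕ.∸ b))               ≡⟨ pos-* (p ℕ.* p ℕ.∸ a) _ ⟩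
        + (p ℕ.* p ℕ.∸ a) * + ((1 ℕ.+ p) ℕ.^ (p ℕ.∸ b))               ≡⟨ cong (_* + ((1 ℕ.+ p) ℕ.^ (p ℕ.∸ b))) (trans (∸≡- (ℕ.<⇒≤ a<p²)) (cong (_- + a) (pos-* p p))) ⟩
        (P² - + a) * + ((1 ℕ.+ p) ℕ.^ (p ℕ.∸ b))                     ≈⟨ ≡-mod-* (-x≡x-m aA) ([1+p]^k≡1+kp (p ℕ.∸ b)) ⟩
        - A * (1ℤ + + (p ℕ.∸ b) * P)                                  ≈⟨ ≡-mod-* (≡-mod-refl {a = - A}) (≡-mod-+ (≡-mod-refl {a = 1ℤ}) (*P-≡-mod p∸b≡-B)) ⟩
        - A * (1ℤ + - B * P)                                          ≡⟨ cong (λ x → - A * (1ℤ + x)) (sym (neg-distribˡ-* B P)) ⟩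
        - A * (1ℤ - B * P)                                            ∎
      second′ = ≡-mod-trans (%p≡ _) p∸b≡-B

    ==⇒≡ : ∀ {g h} → T (_==_ p g h) → g ≡ h
    ==⇒≡ {a , b} {c , d} g==h with Equivalence.to T-∧ g==h
    ... | a≡c , b≡d = cong₂ _,_ (ℕ.≡ᵇ⇒≡ a c a≡c) (ℕ.≡ᵇ⇒≡ b d b≡d)

    ≡⇒== : ∀ {g h} → g ≡ h → T (_==_ p g h)
    ≡⇒== {a , b} refl = Equivalence.from T-∧ (ℕ.≡⇒≡ᵇ a a refl , ℕ.≡⇒≡ᵇ b b refl)

    0<p : 0 ℕ.< p
    0<p = ℕ.>-nonZero⁻¹ p

    0<p² : 0 ℕ.< p ℕ.* p
    0<p² = ℕ.>-nonZero⁻¹ (p ℕ.* p)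

    pow-valid : ∀ g n → Valid p (pow p g n)
    pow-valid g zero    = 0<p² , 0<p
    pow-valid g (suc n) = mul-valid (pow p g n) g

    coords-pow-gx : ∀ n → Coords (pow p (gx p) n) (+ n) 0ℤ
    coords-pow-gx zero    = coords-self _
    coords-pow-gx (suc n) = coords-cong (coords-mul (coords-pow-gx n) (coords-self (gx p)))
      (≡-mod-reflexive (trans (identity (+ n) P) (sym (pos-+ 1 n)))) ≡-mod-refl
      where identity : ∀ n x → n + 1ℤ * (1ℤ + 0ℤ * x) ≡ 1ℤ + n
            identity = solve-∀

    coords-pow-gy : ∀ n → Coords (pow p (gy p) n) 0ℤ (+ n)
    coords-pow-gy zero    = coords-self _
    coords-pow-gy (suc n) = coords-cong (coords-mul (coords-pow-gy n) (coords-self (gy p)))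
      (≡-mod-reflexive (identity (+ n) P)) (≡-mod-reflexive (trans (+-comm (+ n) 1ℤ) (sym (pos-+ 1 n))))
      where identity : ∀ n x → 0ℤ + 0ℤ * (1ℤ + n * x) ≡ 0ℤ
            identity = solve-∀

    coords-pow-gz : ∀ n → Coords (pow p (gz p) n) (+ n * P) 0ℤ
    coords-pow-gz zero    = coords-cong (coords-self _) (≡-mod-reflexive (sym (*-zeroˡ P))) ≡-mod-refl
    coords-pow-gz (suc n) = coords-cong (coords-mul (coords-pow-gz n) (coords-pow-gx p))
      (≡-mod-reflexive (trans (identity (+ n) P) (cong (_* P) (sym (pos-+ 1 n))))) ≡-mod-refl
      where identity : ∀ n x → n * x + x * (1ℤ + 0ℤ * x) ≡ (1ℤ + n) * x
            identity = solve-∀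

    mul-inv-cancelʳ : ∀ u v → Valid p u → Valid p v → mul p (mul p u (inv p v)) v ≡ u
    mul-inv-cancelʳ u@(a , b) v@(c , d) u-valid v-valid =
      coords-injective (mul-valid (mul p u (inv p v)) v) u-valid
        (coords-cong (coords-mul (coords-mul (coords-self u) (coords-inv v-valid (coords-self v))) (coords-self v))
          (≡-mod-multiple (+ c * + b * + d) (identity₁ (+ a) (+ b) (+ c) (+ d) P)) (≡-mod-reflexive (identity₂ (+ b) (+ d))))
        (coords-self u)
      where identity₁ : ∀ a b c d x → (a + (- c * (1ℤ - d * x)) * (1ℤ + b * x)) + c * (1ℤ + (b + - d) * x)
                                      ≡ a + (c * b * d) * (x * x)
            identity₁ = solve-∀
            identity₂ : ∀ b d → b + - d + d ≡ b
            identity₂ = solve-∀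

    mul-identityˡ : ∀ v → Valid p v → mul p (e p) v ≡ v
    mul-identityˡ v@(c , d) v-valid =
      coords-injective (mul-valid (e p) v) v-valid
        (coords-cong (coords-mul (coords-self (e p)) (coords-self v)) (≡-mod-reflexive (identity (+ c) P)) (≡-mod-reflexive (+-identityˡ (+ d))))
        (coords-self v)
      where identity : ∀ c x → 0ℤ + c * (1ℤ + 0ℤ * x) ≡ c
            identity = solve-∀

    inv-involutive : ∀ g → Valid p g → inv p (inv p g) ≡ g
    inv-involutive g@(a , b) g-valid =
      coords-injective (inv-valid (inv p g)) g-valid
        (coords-cong (coords-inv (inv-valid g) (coords-inv g-valid (coords-self g)))
          (≡-mod-multiple (- (+ a * + b * + b)) (identity (+ a) (+ b) P)) (≡-mod-reflexive (neg-involutive (+ b))))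
        (coords-self g)
      where identity : ∀ a b x → - (- a * (1ℤ - b * x)) * (1ℤ - - b * x) ≡ a + (- (a * b * b)) * (x * x)
            identity = solve-∀

module SumsOverG where

  open import Data.Nat.Base
  open import Data.Nat.Properties
  open import Data.Bool.Base using (Bool; true; false; _∧_; _∨_; T)
  open import Data.List.Base using (List; []; _∷_; map; concatMap; upTo; applyUpTo)
  open import Data.List.Properties using (map-applyUpTo; map-concatMap; map-∘)
  open import Data.Nat.ListAction using (sum)
  open import Data.Nat.ListAction.Properties using (sum-++)
  open import Data.Product.Base using (_×_; _,_; proj₁; proj₂; ∃-syntax)
  open import Data.Empty using (⊥-elim)
  open import Function.Base using (_∘_)
  open import Relation.Nullary using (¬_; contradiction)
  open import Relation.Binary.PropositionalEquality
  open import Defs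
  open FiniteSums
  open GroupArithmetic

  infix 4 _∈_

  _∈_ : {A : Set} → A → (A → Bool) → Set
  x ∈ S = T (S x)

  T-ext : ∀ {a b} → (T a → T b) → (T b → T a) → a ≡ b
  T-ext {true}  {true}  _   _   = refl
  T-ext {true}  {false} a⇒b _   = contradiction _ a⇒b
  T-ext {false} {true}  _   b⇒a = contradiction _ b⇒a
  T-ext {false} {false} _   _   = refl

  sum-concatMap : ∀ {A : Set} (h : A → List ℕ) xs → sum (concatMap h xs) ≡ sum (map (sum ∘ h) xs)
  sum-concatMap h []       = refl
  sum-concatMap h (x ∷ xs) = trans (sum-++ (h x) _) (cong (sum (h x) +_) (sum-concatMap h xs))

  module Sums (p : ℕ) .{{_ : NonZero p}} where

    open Arithmetic p

    ind≤1 : ∀ b → ind p b ≤ 1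
    ind≤1 true  = ≤-refl
    ind≤1 false = z≤n

    ind-∧ : ∀ a b → ind p (a ∧ b) ≡ ind p a * ind p b
    ind-∧ true  b = sym (+-identityʳ (ind p b))
    ind-∧ false b = refl

    ind-∨-disjoint : ∀ a b → ¬ (T a × T b) → ind p (a ∨ b) ≡ ind p a + ind p b
    ind-∨-disjoint true  true  disjoint = contradiction _ disjoint
    ind-∨-disjoint true  false disjoint = refl
    ind-∨-disjoint false b     disjoint = refl

    ind-T : ∀ {b} → T b → ind p b ≡ 1
    ind-T {true} _ = refl

    ind-¬T : ∀ {b} → ¬ T b → ind p b ≡ 0
    ind-¬T {true}  ¬t = contradiction _ ¬t
    ind-¬T {false} ¬t = refl

    ind-pos⇒T : ∀ {b} → 0 < ind p b → T b
    ind-pos⇒T {true} _ = _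

    ind-*-pos⇒T : ∀ a b → 0 < ind p a * ind p b → T a × T b
    ind-*-pos⇒T true true _ = _ , _

    ind-*≤1 : ∀ a b → ind p a * ind p b ≤ 1
    ind-*≤1 true  b = ≤-trans (≤-reflexive (+-identityʳ (ind p b))) (ind≤1 b)
    ind-*≤1 false b = z≤n


    ΣG : (G p → ℕ) → ℕ
    ΣG F = sum (map F (elems p))

    ΣG-∑∑ : ∀ F → ΣG F ≡ ∑[ a < p * p ] ∑[ b < p ] F (a , b)
    ΣG-∑∑ F = begin
      sum (map F (concatMap row (upTo (p * p))))                     ≡⟨ cong sum (map-concatMap F row (upTo (p * p))) ⟩
      sum (concatMap (map F ∘ row) (upTo (p * p)))                   ≡⟨ sum-concatMap (map F ∘ row) (upTo (p * p)) ⟩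
      sum (map (sum ∘ map F ∘ row) (upTo (p * p)))                   ≡⟨ cong sum (map-applyUpTo (λ a → a) _ (p * p)) ⟩
      ∑[ a < p * p ] sum (map F (row a))                              ≡⟨ ∑-cong (p * p) (λ a _ → cong sum (sym (map-∘ (upTo p)))) ⟩
      ∑[ a < p * p ] sum (map (λ b → F (a , b)) (upTo p))             ≡⟨ ∑-cong (p * p) (λ a _ → cong sum (map-applyUpTo (λ b → b) _ p)) ⟩
      ∑[ a < p * p ] ∑[ b < p ] F (a , b)                              ∎
      where open ≡-Reasoning
            row : ℕ → List (G p)
            row a = map (a ,_) (upTo p)

    ΣG-cong : ∀ {F F′} → (∀ v → Valid p v → F v ≡ F′ v) → ΣG F ≡ ΣG F′
    ΣG-cong {F} {F′} F≡F′ = trans (ΣG-∑∑ F)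
      (trans (∑-cong (p * p) (λ a a< → ∑-cong p (λ b b< → F≡F′ (a , b) (a< , b<)))) (sym (ΣG-∑∑ F′)))

    ΣG-mono-≤ : ∀ {F F′} → (∀ v → Valid p v → F v ≤ F′ v) → ΣG F ≤ ΣG F′
    ΣG-mono-≤ {F} {F′} F≤F′ = subst₂ _≤_ (sym (ΣG-∑∑ F)) (sym (ΣG-∑∑ F′))
      (∑-mono-≤ (p * p) (λ a a< → ∑-mono-≤ p (λ b b< → F≤F′ (a , b) (a< , b<))))

    ΣG-distrib-+ : ∀ F F′ → ΣG (λ v → F v + F′ v) ≡ ΣG F + ΣG F′
    ΣG-distrib-+ F F′ = trans (ΣG-∑∑ _)
      (trans (∑-cong (p * p) (λ a _ → ∑-distrib-+ p _ _))
        (trans (∑-distrib-+ (p * p) _ _) (sym (cong₂ _+_ (ΣG-∑∑ F) (ΣG-∑∑ F′)))))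

    ΣG-distribˡ-* : ∀ c F → ΣG (λ v → c * F v) ≡ c * ΣG F
    ΣG-distribˡ-* c F = trans (ΣG-∑∑ _)
      (trans (∑-cong (p * p) (λ a _ → ∑-distribˡ-* p c _))
        (trans (∑-distribˡ-* (p * p) c _) (cong (c *_) (sym (ΣG-∑∑ F)))))

    ΣG-const : ∀ c → ΣG (λ _ → c) ≡ p * p * p * c
    ΣG-const c = trans (ΣG-∑∑ _)
      (trans (∑-cong (p * p) (λ _ _ → ∑-const p c)) (trans (∑-const (p * p) (p * c)) (sym (*-assoc (p * p) p c))))

    ΣG-∑-comm : ∀ n (F : ℕ → G p → ℕ) → ΣG (λ v → ∑[ k < n ] F k v) ≡ ∑[ k < n ] ΣG (F k)
    ΣG-∑-comm n F = trans (ΣG-∑∑ _)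
      (trans (∑-cong (p * p) (λ a _ → ∑-comm p n _))
        (trans (∑-comm (p * p) n _) (∑-cong n (λ k _ → sym (ΣG-∑∑ (F k))))))

    ΣG-comm : ∀ (F : G p → G p → ℕ) → ΣG (λ u → ΣG (F u)) ≡ ΣG (λ v → ΣG (λ u → F u v))
    ΣG-comm F = begin
      ΣG (λ u → ΣG (F u))                                            ≡⟨ ΣG-cong (λ u _ → ΣG-∑∑ (F u)) ⟩
      ΣG (λ u → ∑[ c < p * p ] ∑[ d < p ] F u (c , d))                ≡⟨ ΣG-∑-comm (p * p) _ ⟩
      ∑[ c < p * p ] ΣG (λ u → ∑[ d < p ] F u (c , d))                ≡⟨ ∑-cong (p * p) (λ c _ → ΣG-∑-comm p _) ⟩
      ∑[ c < p * p ] ∑[ d < p ] ΣG (λ u → F u (c , d))                ≡⟨ ΣG-∑∑ _ ⟨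
      ΣG (λ v → ΣG (λ u → F u v))                                    ∎
      where open ≡-Reasoning

    ΣG-single : ∀ w F → Valid p w → (∀ v → Valid p v → v ≢ w → F v ≡ 0) → ΣG F ≡ F w
    ΣG-single (a₀ , b₀) F (a₀< , b₀<) others = trans (ΣG-∑∑ F)
      (trans (∑-single (p * p) a₀ a₀< (λ a a< a≢a₀ → ∑-zero p (λ b b< → others (a , b) (a< , b<) (a≢a₀ ∘ cong proj₁))))
        (∑-single p b₀ b₀< (λ b b< b≢b₀ → others (a₀ , b) (a₀< , b<) (b≢b₀ ∘ cong proj₂))))

    term≤ΣG : ∀ F w → Valid p w → F w ≤ ΣG F
    term≤ΣG F (a , b) (a< , b<) = ≤-trans (term≤∑ p (λ b → F (a , b)) b b<)
      (≤-trans (term≤∑ (p * p) (λ a → ∑[ b < p ] F (a , b)) a a<) (≤-reflexive (sym (ΣG-∑∑ F))))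

    ΣG-squeeze : ∀ (F F′ : G p → ℕ) → (∀ v → Valid p v → F v ≤ F′ v) → ΣG F′ ≤ ΣG F →
                 ∀ v → Valid p v → F v ≡ F′ v
    ΣG-squeeze F F′ F≤F′ ΣF′≤ΣF (a , b) (a< , b<) =
      ∑-squeeze p (λ b → F (a , b)) (λ b → F′ (a , b)) (λ b b< → F≤F′ (a , b) (a< , b<))
        (≤-reflexive (sym (rows-equal a a<))) b b<
      where
      rows-equal : ∀ a → a < p * p → ∑[ b < p ] F (a , b) ≡ ∑[ b < p ] F′ (a , b)
      rows-equal = ∑-squeeze (p * p) _ _ (λ a a< → ∑-mono-≤ p (λ b b< → F≤F′ (a , b) (a< , b<)))
                     (subst₂ _≤_ (ΣG-∑∑ F′) (ΣG-∑∑ F) ΣF′≤ΣF)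

    ΣG-≤1 : ∀ (F : G p → ℕ) → (∀ v → Valid p v → F v ≤ 1) →
            (∀ v w → Valid p v → Valid p w → 0 < F v → 0 < F w → v ≡ w) → ΣG F ≤ 1
    ΣG-≤1 F F≤1 unique = subst (_≤ 1) (sym (ΣG-∑∑ F))
      (∑-≤-atMostOnePositive (p * p) _ 1
        (λ a a< → ∑-≤-atMostOnePositive p _ 1 (λ b b< → F≤1 (a , b) (a< , b<))
                    (λ b b′ b< b′< Fb>0 Fb′>0 → cong proj₂ (unique _ _ (a< , b<) (a< , b′<) Fb>0 Fb′>0)))
        (λ a a′ a< a′< row>0 row′>0 → same-row a a′ a< a′< (∑-pos⇒∃ p _ row>0) (∑-pos⇒∃ p _ row′>0)))
      where
      same-row : ∀ a a′ → a < p * p → a′ < p * p → ∃[ b ] (b < p × 0 < F (a , b)) →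
                 ∃[ b′ ] (b′ < p × 0 < F (a′ , b′)) → a ≡ a′
      same-row a a′ a< a′< (b , b< , Fab>0) (b′ , b′< , Fab′>0) =
        cong proj₁ (unique _ _ (a< , b<) (a′< , b′<) Fab>0 Fab′>0)

    record Parametrisation (S : Subset p) (m n : ℕ) : Set where
      field
        point     : ℕ → ℕ → G p
        valid     : ∀ j k → j < m → k < n → Valid p (point j k)
        member    : ∀ j k → j < m → k < n → point j k ∈ S
        onto      : ∀ v → Valid p v → v ∈ S → ∃[ j ] ∃[ k ] (j < m × k < n × point j k ≡ v)
        injective : ∀ j k j′ k′ → j < m → k < n → j′ < m → k′ < n →
                    point j k ≡ point j′ k′ → j ≡ j′ × k ≡ k′

    module _ {S m n} (φ : Parametrisation S m n) where
      open Parametrisation φ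

      private
        ind≡∑∑ : ∀ v → Valid p v → ind p (S v) ≡ ∑[ j < m ] ∑[ k < n ] ind p (_==_ p (point j k) v)
        ind≡∑∑ v v-valid with S v in Sv≡
        ... | false = sym (∑-zero m (λ j j< → ∑-zero n (λ k k< → ind-¬T (point≢v j k j< k<))))
          where point≢v : ∀ j k → j < m → k < n → ¬ T (_==_ p (point j k) v)
                point≢v j k j< k< ==v = subst T Sv≡ (subst (_∈ S) (==⇒≡ ==v) (member j k j< k<))
        ... | true with onto v v-valid (subst T (sym Sv≡) _)
        ...   | j₀ , k₀ , j₀< , k₀< , point≡v = sym (begin
          ∑[ j < m ] ∑[ k < n ] ind p (_==_ p (point j k) v)   ≡⟨ ∑-single m j₀ j₀< other-rows ⟩
          ∑[ k < n ] ind p (_==_ p (point j₀ k) v)             ≡⟨ ∑-single n k₀ k₀< other-columns ⟩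
          ind p (_==_ p (point j₀ k₀) v)                       ≡⟨ ind-T (≡⇒== point≡v) ⟩
          1                                                    ∎)
          where
          open ≡-Reasoning
          other-rows : ∀ j → j < m → j ≢ j₀ → ∑[ k < n ] ind p (_==_ p (point j k) v) ≡ 0
          other-rows j j< j≢j₀ = ∑-zero n (λ k k< → ind-¬T (λ ==v →
            j≢j₀ (proj₁ (injective j k j₀ k₀ j< k< j₀< k₀< (trans (==⇒≡ ==v) (sym point≡v))))))
          other-columns : ∀ k → k < n → k ≢ k₀ → ind p (_==_ p (point j₀ k) v) ≡ 0
          other-columns k k< k≢k₀ = ind-¬T (λ ==v →
            k≢k₀ (proj₂ (injective j₀ k j₀ k₀ j₀< k< j₀< k₀< (trans (==⇒≡ ==v) (sym point≡v)))))

      ΣG-parametrised : ∀ (F : G p → ℕ) → ΣG (λ v → ind p (S v) * F v) ≡ ∑[ j < m ] ∑[ k < n ] F (point j k)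
      ΣG-parametrised F = begin
        ΣG (λ v → ind p (S v) * F v)                                                ≡⟨ ΣG-cong expand ⟩
        ΣG (λ v → ∑[ j < m ] ∑[ k < n ] (ind p (_==_ p (point j k) v) * F v))        ≡⟨ ΣG-∑-comm m _ ⟩
        ∑[ j < m ] ΣG (λ v → ∑[ k < n ] (ind p (_==_ p (point j k) v) * F v))        ≡⟨ ∑-cong m (λ j _ → ΣG-∑-comm n _) ⟩
        ∑[ j < m ] ∑[ k < n ] ΣG (λ v → ind p (_==_ p (point j k) v) * F v)          ≡⟨ ∑-cong m (λ j j< → ∑-cong n (λ k k< →
                                                                                        trans (ΣG-single (point j k) _ (valid j k j< k<) (λ v _ → off-point j k v))
                                                                                              (cong (_* F (point j k)) (ind-T (≡⇒== {point j k} refl))))) ⟩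
        ∑[ j < m ] ∑[ k < n ] (1 * F (point j k))                                    ≡⟨ ∑-cong m (λ j _ → ∑-cong n (λ k _ → *-identityˡ _)) ⟩
        ∑[ j < m ] ∑[ k < n ] F (point j k)                                          ∎
        where
        open ≡-Reasoning
        expand : ∀ v → Valid p v → ind p (S v) * F v ≡ ∑[ j < m ] ∑[ k < n ] (ind p (_==_ p (point j k) v) * F v)
        expand v v-valid = begin
          ind p (S v) * F v                                                  ≡⟨ cong (_* F v) (ind≡∑∑ v v-valid) ⟩
          (∑[ j < m ] ∑[ k < n ] ind p (_==_ p (point j k) v)) * F v         ≡⟨ ∑-distribʳ-* m (F v) _ ⟨
          ∑[ j < m ] ((∑[ k < n ] ind p (_==_ p (point j k) v)) * F v)       ≡⟨ ∑-cong m (λ j _ → ∑-distribʳ-* n (F v) _) ⟨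
          ∑[ j < m ] ∑[ k < n ] (ind p (_==_ p (point j k) v) * F v)         ∎
        off-point : ∀ j k v → v ≢ point j k → ind p (_==_ p (point j k) v) * F v ≡ 0
        off-point j k v v≢point = cong (_* F v) (ind-¬T (λ ==v → v≢point (sym (==⇒≡ ==v))))

      card-parametrised : card p S ≡ m * n
      card-parametrised = begin
        ΣG (λ v → ind p (S v))                ≡⟨ ΣG-cong (λ v _ → sym (*-identityʳ _)) ⟩
        ΣG (λ v → ind p (S v) * 1)            ≡⟨ ΣG-parametrised (λ _ → 1) ⟩
        ∑[ j < m ] ∑[ k < n ] 1                ≡⟨ ∑-cong m (λ _ _ → trans (∑-const n 1) (*-identityʳ n)) ⟩
        ∑[ j < m ] n                           ≡⟨ ∑-const m n ⟩
        m * n                                  ∎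
        where open ≡-Reasoning

    ΣG-∪ : ∀ {A B m n m′ n′} (φ : Parametrisation A m n) (χ : Parametrisation B m′ n′) →
           (∀ v → Valid p v → ¬ (v ∈ A × v ∈ B)) → ∀ (F : G p → ℕ) →
           ΣG (λ v → ind p (A v ∨ B v) * F v)
             ≡ ∑[ j < m ] ∑[ k < n ] F (Parametrisation.point φ j k) + ∑[ j < m′ ] ∑[ k < n′ ] F (Parametrisation.point χ j k)
    ΣG-∪ {A} {B} φ χ disjoint F = begin
      ΣG (λ v → ind p (A v ∨ B v) * F v)                     ≡⟨ ΣG-cong split ⟩
      ΣG (λ v → ind p (A v) * F v + ind p (B v) * F v)       ≡⟨ ΣG-distrib-+ _ _ ⟩
      ΣG (λ v → ind p (A v) * F v) + ΣG (λ v → ind p (B v) * F v)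
                                                             ≡⟨ cong₂ _+_ (ΣG-parametrised φ F) (ΣG-parametrised χ F) ⟩
      _                                                      ∎
      where
      open ≡-Reasoning
      split : ∀ v → Valid p v → ind p (A v ∨ B v) * F v ≡ ind p (A v) * F v + ind p (B v) * F v
      split v v-valid = trans (cong (_* F v) (ind-∨-disjoint (A v) (B v) (disjoint v v-valid))) (*-distribʳ-+ (F v) (ind p (A v)) (ind p (B v)))

    card-∪ : ∀ {A B m n m′ n′} → Parametrisation A m n → Parametrisation B m′ n′ →
             (∀ v → Valid p v → ¬ (v ∈ A × v ∈ B)) → card p (λ v → A v ∨ B v) ≡ m * n + m′ * n′
    card-∪ {A} {B} {m} {n} {m′} {n′} φ χ disjoint = begin
      ΣG (λ v → ind p (A v ∨ B v))                                ≡⟨ ΣG-cong (λ v _ → sym (*-identityʳ _)) ⟩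
      ΣG (λ v → ind p (A v ∨ B v) * 1)                            ≡⟨ ΣG-∪ φ χ disjoint (λ _ → 1) ⟩
      ∑[ j < m ] ∑[ k < n ] 1 + ∑[ j < m′ ] ∑[ k < n′ ] 1          ≡⟨ cong₂ _+_ (rectangle m n) (rectangle m′ n′) ⟩
      m * n + m′ * n′                                             ∎
      where
      open ≡-Reasoning
      rectangle : ∀ m n → ∑[ j < m ] ∑[ k < n ] 1 ≡ m * n
      rectangle m n = trans (∑-cong m (λ _ _ → trans (∑-const n 1) (*-identityʳ n))) (∑-const m n)

    row≤1 : ∀ (S : Subset p) n (pt : ℕ → G p) → (∀ k₁ k₂ → k₁ < n → k₂ < n → pt k₁ ∈ S → pt k₂ ∈ S → k₁ ≡ k₂) →
            ∑[ k < n ] ind p (S (pt k)) ≤ 1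
    row≤1 S n pt unique = ∑-≤-atMostOnePositive n _ 1 (λ k _ → ind≤1 (S (pt k)))
      (λ k₁ k₂ k₁<n k₂<n pos₁ pos₂ → unique k₁ k₂ k₁<n k₂<n (ind-pos⇒T pos₁) (ind-pos⇒T pos₂))

    row≡0 : ∀ (S : Subset p) n (pt : ℕ → G p) → (∀ k → k < n → ¬ pt k ∈ S) → ∑[ k < n ] ind p (S (pt k)) ≡ 0
    row≡0 S n pt none = ∑-zero n (λ k k<n → ind-¬T (none k k<n))

    row≤n : ∀ (S : Subset p) n (pt : ℕ → G p) → ∑[ k < n ] ind p (S (pt k)) ≤ n
    row≤n S n pt = ∑-≤-count n (λ k _ → ind≤1 (S (pt k)))

    row-pos⇒∈ : ∀ (S : Subset p) n (pt : ℕ → G p) → 0 < ∑[ k < n ] ind p (S (pt k)) → ∃[ k ] (k < n × pt k ∈ S)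
    row-pos⇒∈ S n pt pos with ∑-pos⇒∃ n _ pos
    ... | k , k<n , ind>0 = k , k<n , ind-pos⇒T ind>0

module Subgroups where

  open import Data.Nat.Base as ℕ using (ℕ; zero; suc; NonZero; _/_; _<_; _≤_; z<s; s≤s; z≤n)
  import Data.Nat.Properties as ℕ
  import Data.Nat.DivMod as ℕ
  open import Data.Integer.Base using (+_; 0ℤ; _*_)
  open import Data.Integer.Divisibility.Signed using (_∣_; ∣⇒∣ᵤ; ∣n⇒∣m*n; ∣-refl)
  open import Data.List.Base using (List; []; _∷_; map; length; upTo)
  open import Data.List.Relation.Unary.Any.Properties using (any⁺; any⁻; applyUpTo⁺; applyUpTo⁻)
  open import Data.Nat.ListAction using (sum)
  open import Data.Product.Base using (_×_; _,_; proj₁; proj₂; ∃-syntax)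
  open import Function.Base using (id)
  open import Relation.Binary.PropositionalEquality
  open import Defs
  open Congruence
  open GroupArithmetic
  open SumsOverG

  length≡sum-map-1 : ∀ {A : Set} (xs : List A) → length xs ≡ sum (map (λ _ → 1) xs)
  length≡sum-map-1 []       = refl
  length≡sum-map-1 (x ∷ xs) = cong suc (length≡sum-map-1 xs)

  module Subgroups (p : ℕ) .{{_ : NonZero p}} where

    open Arithmetic p
    open Sums p

    private
      p≤|G| : p ≤ length (elems p)
      p≤|G| = ℕ.≤-trans (ℕ.m≤m*n p (p ℕ.* p)) (ℕ.≤-reflexive (sym (begin
        length (elems p)          ≡⟨ length≡sum-map-1 (elems p) ⟩
        ΣG (λ _ → 1)            ≡⟨ ΣG-const 1 ⟩
        p ℕ.* p ℕ.* p ℕ.* 1       ≡⟨ ℕ.*-identityʳ _ ⟩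
        p ℕ.* p ℕ.* p             ≡⟨ ℕ.*-comm (p ℕ.* p) p ⟩
        p ℕ.* (p ℕ.* p)           ∎)))
        where open ≡-Reasoning

    ∈cyc⇒ : ∀ g w → w ∈ cyc p g → ∃[ j ] (pow p g j ≡ w)
    ∈cyc⇒ g w w∈⟨g⟩ with applyUpTo⁻ id (any⁻ (λ j → _==_ p (pow p g j) w) (upTo (length (elems p))) w∈⟨g⟩)
    ... | j , _ , g^j==w = j , ==⇒≡ g^j==w

    pow∈cyc : ∀ g j → j < p → pow p g j ∈ cyc p g
    pow∈cyc g j j<p = any⁺ (λ k → _==_ p (pow p g k) (pow p g j))
      (applyUpTo⁺ id {n = length (elems p)} (≡⇒== {pow p g j} refl) (ℕ.<-≤-trans j<p p≤|G|))

    pow-gy≡ : ∀ b → b < p → pow p (gy p) b ≡ (0 , b)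
    pow-gy≡ b b<p = coords-injective (pow-valid (gy p) b) (0<p² , b<p) (coords-pow-gy b) (coords-self (0 , b))

    pow-gz≡ : ∀ k → k < p → pow p (gz p) k ≡ (k ℕ.* p , 0)
    pow-gz≡ k k<p = coords-injective (pow-valid (gz p) k) (ℕ.*-monoˡ-< p k<p , 0<p) (coords-pow-gz k)
      (coords-cong (coords-self (k ℕ.* p , 0)) (≡-mod-reflexive (pos-* k p)) ≡-mod-refl)
      where open import Data.Integer.Properties using (pos-*)

    ∈Y⇒first≡0 : ∀ w → Valid p w → w ∈ Ysub p → proj₁ w ≡ 0
    ∈Y⇒first≡0 w (a<p² , _) w∈Y = ≡-mod-P²⇒≡ a<p² 0<p² (first (subst (λ g → Coords g 0ℤ (+ j)) y^j≡w (coords-pow-gy j)))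
      where j = proj₁ (∈cyc⇒ (gy p) w w∈Y)
            y^j≡w = proj₂ (∈cyc⇒ (gy p) w w∈Y)

    ∈Y : ∀ b → b < p → (0 , b) ∈ Ysub p
    ∈Y b b<p = subst (_∈ Ysub p) (pow-gy≡ b b<p) (pow∈cyc (gy p) b b<p)

    ∈Z⇒ : ∀ w → Valid p w → w ∈ Zsub p → proj₂ w ≡ 0 × P ∣ + proj₁ w
    ∈Z⇒ w (_ , b<p) w∈Z = ≡-mod⇒≡ b<p 0<p (second w-coords)
                        , ≡-mod-∣ (≡-mod-sym (≡-mod-P²⇒P (first w-coords))) (∣n⇒∣m*n (+ j) ∣-refl)
      where j = proj₁ (∈cyc⇒ (gz p) w w∈Z)
            w-coords = subst (λ g → Coords g (+ j * P) 0ℤ) (proj₂ (∈cyc⇒ (gz p) w w∈Z)) (coords-pow-gz j)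

    ∈Z⇒multiple : ∀ w → Valid p w → w ∈ Zsub p → ∃[ k ] (k < p × (k ℕ.* p , 0) ≡ w)
    ∈Z⇒multiple (a , b) (a<p² , b<p) w∈Z =
      a / p , ℕ.m<n*o⇒m/o<n a<p² , cong₂ _,_ (ℕ.m/n*n≡m (∣⇒∣ᵤ (proj₂ facts))) (sym (proj₁ facts))
      where facts = ∈Z⇒ (a , b) (a<p² , b<p) w∈Z

    ∈Z : ∀ k → k < p → (k ℕ.* p , 0) ∈ Zsub p
    ∈Z k k<p = subst (_∈ Zsub p) (pow-gz≡ k k<p) (pow∈cyc (gz p) k k<p)

    ∣⇒∈Z : ∀ a → a < p ℕ.* p → P ∣ + a → (a , 0) ∈ Zsub p
    ∣⇒∈Z a a<p² p∣a = subst (λ a′ → (a′ , 0) ∈ Zsub p) (ℕ.m/n*n≡m (∣⇒∣ᵤ p∣a)) (∈Z (a / p) (ℕ.m<n*o⇒m/o<n a<p²))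

    Y-parametrisation : Parametrisation (Ysub p) 1 p
    Y-parametrisation = record
      { point     = λ _ b → (0 , b)
      ; valid     = λ _ b _ b<p → 0<p² , b<p
      ; member    = λ _ b _ b<p → ∈Y b b<p
      ; onto      = λ { w@(a , b) w-valid@(_ , b<p) w∈Y → 0 , b , z<s , b<p , cong (_, b) (sym (∈Y⇒first≡0 w w-valid w∈Y)) }
      ; injective = λ { _ _ _ _ (s≤s z≤n) _ (s≤s z≤n) _ eq → refl , cong proj₂ eq }
      }

    Z-parametrisation : Parametrisation (Zsub p) 1 p
    Z-parametrisation = record
      { point     = λ _ k → (k ℕ.* p , 0)
      ; valid     = λ _ k _ k<p → ℕ.*-monoˡ-< p k<p , 0<p
      ; member    = λ _ k _ k<p → ∈Z k k<p
      ; onto      = λ w w-valid w∈Z → let k , k<p , kp≡w = ∈Z⇒multiple w w-valid w∈Z in 0 , k , z<s , k<p , kp≡w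
      ; injective = λ { _ k _ k′ (s≤s z≤n) _ (s≤s z≤n) _ eq → refl , ℕ.*-cancelʳ-≡ k k′ p (cong proj₁ eq) }
      }

    card-Y : card p (Ysub p) ≡ p
    card-Y = trans (card-parametrised Y-parametrisation) (ℕ.+-identityʳ p)

    card-Z : card p (Zsub p) ≡ p
    card-Z = trans (card-parametrised Z-parametrisation) (ℕ.+-identityʳ p)

    coords-∈Y : ∀ {w A B} → Valid p w → Coords w A B → w ∈ Ysub p → A ≡ 0ℤ mod P²
    coords-∈Y {w} w-valid w-coords w∈Y =
      ≡-mod-trans (≡-mod-sym (first w-coords)) (≡-mod-reflexive (cong +_ (∈Y⇒first≡0 w w-valid w∈Y)))

    coords-∈Z : ∀ {w A B} → Valid p w → Coords w A B → w ∈ Zsub p → P ∣ A × P ∣ B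
    coords-∈Z {w} w-valid w-coords w∈Z =
        ≡-mod-∣ (≡-mod-P²⇒P (first w-coords)) (proj₂ facts)
      , ≡-mod-∣ (second w-coords) (subst (λ b → P ∣ + b) (sym (proj₁ facts)) (∣n⇒∣m*n 0ℤ ∣-refl))
      where facts = ∈Z⇒ w w-valid w∈Z

    coords-∈Y⁻ : ∀ {w A B} → Valid p w → Coords w A B → A ≡ 0ℤ mod P² → w ∈ Ysub p
    coords-∈Y⁻ {a , b} (a<p² , b<p) w-coords A≡0 =
      subst (λ a → (a , b) ∈ Ysub p) (sym (≡-mod-P²⇒≡ a<p² 0<p² (≡-mod-trans (first w-coords) A≡0))) (∈Y b b<p)

    coords-∈Z⁻ : ∀ {w A B} → Valid p w → Coords w A B → P ∣ A → P ∣ B → w ∈ Zsub p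
    coords-∈Z⁻ {a , b} (a<p² , b<p) w-coords P∣A P∣B =
      subst (λ b → (a , b) ∈ Zsub p) (sym b≡0) (∣⇒∈Z a a<p² (≡-mod-∣ (≡-mod-sym (≡-mod-P²⇒P (first w-coords))) P∣A))
      where b≡0 : b ≡ 0
            b≡0 = ≡-mod⇒≡ b<p 0<p (≡-mod-trans (second w-coords) (∣⇒≡0-mod P∣B))

module Coefficients where

  open import Data.Nat.Base
  open import Data.Nat.Properties
  open import Data.Nat.Tactic.RingSolver using (solve-∀)
  open import Data.Bool.Base using (Bool; true; false; _∧_; if_then_else_; T)
  open import Data.Product.Base using (_,_)
  open import Relation.Binary.PropositionalEquality
  open import Relation.Nullary using (¬_)
  open import Data.Empty using (⊥-elim)
  open import Defs
  open GroupArithmetic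
  open SumsOverG

  module Coefficients (p : ℕ) .{{_ : NonZero p}} where

    open Arithmetic p
    open Sums p

    coincidences : Subset p → G p → ℕ
    coincidences S g = ΣG (λ v → ind p (S v) * ind p (S (mul p g v)))

    target : Subset p → G p → ℕ
    target N g = (if _==_ p g (e p) then p * p else 0) + (if N g then 0 else p)

    private
      ind-∧∧≤ : ∀ a b c → ind p (a ∧ (b ∧ c)) ≤ ind p b * ind p a
      ind-∧∧≤ true  true  true  = ≤-refl
      ind-∧∧≤ true  true  false = z≤n
      ind-∧∧≤ true  false _     = z≤n
      ind-∧∧≤ false _     _     = z≤n

      ind-∧∧ : ∀ a b c → ind p (a ∧ (b ∧ c)) ≡ ind p a * ind p b * ind p c
      ind-∧∧ a b c = trans (ind-∧ a (b ∧ c)) (trans (cong (ind p a *_) (ind-∧ b c)) (sym (*-assoc (ind p a) _ _)))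

      ΣG-ind-== : ∀ w → Valid p w → ΣG (λ g → ind p (_==_ p w g)) ≡ 1
      ΣG-ind-== w w-valid = trans (ΣG-single w _ w-valid (λ g _ g≢w → ind-¬T (λ w==g → g≢w (sym (==⇒≡ w==g)))))
                                  (ind-T (≡⇒== {w} refl))

    coeff≤coincidences : ∀ S g → Valid p g → coeff p S g ≤ coincidences S g
    coeff≤coincidences S g g-valid = begin
      ΣG (λ u → ΣG (λ v → ind p (S u ∧ (S v ∧ _==_ p (mul p u (inv p v)) g))))   ≡⟨ ΣG-comm _ ⟩
      ΣG (λ v → ΣG (λ u → ind p (S u ∧ (S v ∧ _==_ p (mul p u (inv p v)) g))))   ≤⟨ ΣG-mono-≤ at-most-gv ⟩
      coincidences S g                                                                ∎
      where
      open ≤-Reasoning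
      at-most-gv : ∀ v → Valid p v →
                   ΣG (λ u → ind p (S u ∧ (S v ∧ _==_ p (mul p u (inv p v)) g))) ≤ ind p (S v) * ind p (S (mul p g v))
      at-most-gv v v-valid = ≤-trans (≤-reflexive (ΣG-single (mul p g v) _ (mul-valid g v) only-gv))
                                     (ind-∧∧≤ (S (mul p g v)) (S v) _)
        where
        only-gv : ∀ u → Valid p u → u ≢ mul p g v → ind p (S u ∧ (S v ∧ _==_ p (mul p u (inv p v)) g)) ≡ 0
        only-gv u u-valid u≢gv = trans (ind-∧∧ (S u) (S v) _)
          (trans (cong (ind p (S u) * ind p (S v) *_) (ind-¬T (λ uv⁻¹==g →
            u≢gv (trans (sym (mul-inv-cancelʳ u v u-valid v-valid)) (cong (λ w → mul p w v) (==⇒≡ uv⁻¹==g))))))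
            (*-zeroʳ (ind p (S u) * ind p (S v))))

    ΣG-coeff : ∀ S → ΣG (coeff p S) ≡ card p S * card p S
    ΣG-coeff S = begin
      ΣG (λ g → ΣG (λ u → ΣG (λ v → δ u v g)))       ≡⟨ ΣG-comm _ ⟩
      ΣG (λ u → ΣG (λ g → ΣG (λ v → δ u v g)))       ≡⟨ ΣG-cong (λ u _ → ΣG-comm _) ⟩
      ΣG (λ u → ΣG (λ v → ΣG (λ g → δ u v g)))       ≡⟨ ΣG-cong (λ u _ → ΣG-cong (λ v _ → sum-over-g u v)) ⟩
      ΣG (λ u → ΣG (λ v → ind p (S u) * ind p (S v))) ≡⟨ ΣG-cong (λ u _ → ΣG-distribˡ-* (ind p (S u)) _) ⟩
      ΣG (λ u → ind p (S u) * card p S)               ≡⟨ ΣG-cong (λ u _ → *-comm (ind p (S u)) _) ⟩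
      ΣG (λ u → card p S * ind p (S u))               ≡⟨ ΣG-distribˡ-* (card p S) _ ⟩
      card p S * card p S                             ∎
      where
      open ≡-Reasoning
      δ : G p → G p → G p → ℕ
      δ u v g = ind p (S u ∧ (S v ∧ _==_ p (mul p u (inv p v)) g))
      sum-over-g : ∀ u v → ΣG (δ u v) ≡ ind p (S u) * ind p (S v)
      sum-over-g u v = begin
        ΣG (δ u v)                                                          ≡⟨ ΣG-cong (λ g _ → ind-∧∧ (S u) (S v) _) ⟩
        ΣG (λ g → ind p (S u) * ind p (S v) * ind p (_==_ p (mul p u (inv p v)) g)) ≡⟨ ΣG-distribˡ-* (ind p (S u) * ind p (S v)) _ ⟩
        ind p (S u) * ind p (S v) * ΣG (λ g → ind p (_==_ p (mul p u (inv p v)) g)) ≡⟨ cong (ind p (S u) * ind p (S v) *_) (ΣG-ind-== _ (mul-valid u (inv p v))) ⟩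
        ind p (S u) * ind p (S v) * 1                                       ≡⟨ *-identityʳ _ ⟩
        ind p (S u) * ind p (S v)                                           ∎

    ΣG-target : ∀ N → card p N ≡ p → ΣG (target N) ≡ p * p * (p * p)
    ΣG-target N card-N = begin
      ΣG (target N)                                         ≡⟨ ΣG-distrib-+ _ _ ⟩
      ΣG (λ g → if _==_ p g (e p) then p * p else 0) + Σoff ≡⟨ cong (_+ Σoff) Σon≡p² ⟩
      p * p + Σoff                                          ≡⟨ +-comm (p * p) Σoff ⟩
      Σoff + p * p                                          ≡⟨ cong (λ n → Σoff + p * n) card-N ⟨
      Σoff + p * card p N                                   ≡⟨ cong (Σoff +_) (ΣG-distribˡ-* p _) ⟨
      Σoff + ΣG (λ g → p * ind p (N g))                     ≡⟨ ΣG-distrib-+ _ _ ⟨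
      ΣG (λ g → (if N g then 0 else p) + p * ind p (N g))   ≡⟨ ΣG-cong (λ g _ → off+on (N g)) ⟩
      ΣG (λ _ → p)                                          ≡⟨ ΣG-const p ⟩
      p * p * p * p                                         ≡⟨ *-assoc (p * p) p p ⟩
      p * p * (p * p)                                       ∎
      where
      open ≡-Reasoning
      Σoff = ΣG (λ g → if N g then 0 else p)
      Σon≡p² : ΣG (λ g → if _==_ p g (e p) then p * p else 0) ≡ p * p
      Σon≡p² = trans (ΣG-single (e p) _ (0<p² , 0<p) (λ g _ g≢e → if-¬T (λ g==e → g≢e (==⇒≡ g==e)))) (if-T (≡⇒== {e p} refl))
        where
        if-T : ∀ {b} → T b → (if b then p * p else 0) ≡ p * p
        if-T {true} _ = refl
        if-¬T : ∀ {b} → ¬ T b → (if b then p * p else 0) ≡ 0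
        if-¬T {true}  ¬t = ⊥-elim (¬t _)
        if-¬T {false} _  = refl
      off+on : ∀ b → (if b then 0 else p) + p * ind p b ≡ p
      off+on true  = *-identityʳ p
      off+on false = trans (cong (p +_) (*-zeroʳ p)) (+-identityʳ p)

    ≤target : ∀ N g {x} → (g ≡ e p → x ≤ p * p) → (g ≢ e p → g ∈ N → x ≡ 0) → (g ≢ e p → ¬ g ∈ N → x ≤ p) →
              x ≤ target N g
    ≤target N g at-e in-N off-N with _==_ p g (e p) in g==e
    ... | true  = ≤-trans (at-e (==⇒≡ (subst T (sym g==e) _))) (m≤m+n (p * p) _)
    ... | false with N g in Ng
    ...   | true  = ≤-reflexive (in-N (λ g≡e → subst T g==e (≡⇒== g≡e)) _)
    ...   | false = off-N (λ g≡e → subst T g==e (≡⇒== g≡e)) (λ ())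

    coincidences≤card : ∀ S g → coincidences S g ≤ card p S
    coincidences≤card S g = ΣG-mono-≤ (λ v _ → ≤-trans (*-monoʳ-≤ (ind p (S v)) (ind≤1 _)) (≤-reflexive (*-identityʳ _)))

    rds-by-counting : ∀ S N → card p S ≡ p * p → card p N ≡ p →
                      (∀ g → Valid p g → coincidences S g ≤ target N g) → IsRDS p S N (p * p) p (p * p) p
    rds-by-counting S N card-S card-N bound = record
      { index   = trans (cong (p * p *_) card-N) (sym (trans (ΣG-const 1) (*-identityʳ _)))
      ; sizeN   = sym card-N
      ; sizeS   = sym card-S
      ; l-pos   = 0<p
      ; product = ΣG-squeeze (coeff p S) (target N) (λ g g-valid → ≤-trans (coeff≤coincidences S g g-valid) (bound g g-valid))
                    (≤-reflexive (trans (ΣG-target N card-N) (sym (trans (ΣG-coeff S) (cong₂ _*_ card-S card-S)))))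
      }

module Semiregularity where

  open import Data.Nat.Base
  open import Data.Nat.Properties
  open import Data.Bool.Base using (Bool; true; false; _∧_; if_then_else_; T)
  open import Data.Bool.Properties using (T-∧)
  open import Data.Product.Base using (_×_; _,_; proj₁; proj₂)
  open import Data.Empty using (⊥-elim)
  open import Function.Bundles using (Equivalence)
  open import Relation.Binary.PropositionalEquality
  open import Relation.Nullary using (¬_; contradiction)
  open import Defs
  open FiniteSums
  open GroupArithmetic
  open SumsOverG

  module Semiregularity (p : ℕ) .{{_ : NonZero p}} where

    open Arithmetic p
    open Sums p

    record CosetLabelling (N : Subset p) (n : ℕ) : Set where
      field
        label       : G p → ℕ
        label<      : ∀ h → Valid p h → label h < n
        same-label  : ∀ h g → Valid p h → Valid p g → mul p h (inv p g) ∈ N → label h ≡ label g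
        same-coset  : ∀ h g → Valid p h → Valid p g → label h ≡ label g → mul p h (inv p g) ∈ N

    rds-at-most-one-in-coset : ∀ {S N m n k l} → IsRDS p S N m n k l →
      ∀ h₁ h₂ → Valid p h₁ → Valid p h₂ → h₁ ∈ S → h₂ ∈ S → mul p h₁ (inv p h₂) ∈ N → h₁ ≡ h₂
    rds-at-most-one-in-coset {S} {N} {k = k} {l} rds h₁ h₂ h₁-valid h₂-valid h₁∈S h₂∈S w∈N
      with _==_ p (mul p h₁ (inv p h₂)) (e p) in w==e
    ... | true  = begin
      h₁                                  ≡⟨ mul-inv-cancelʳ h₁ h₂ h₁-valid h₂-valid ⟨
      mul p (mul p h₁ (inv p h₂)) h₂      ≡⟨ cong (λ w → mul p w h₂) (==⇒≡ (subst T (sym w==e) _)) ⟩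
      mul p (e p) h₂                      ≡⟨ mul-identityˡ h₂ h₂-valid ⟩
      h₂                                  ∎
      where open ≡-Reasoning
    ... | false = contradiction (≤-trans 1≤coeff (≤-reflexive coeff≡0)) λ ()
      where
      w = mul p h₁ (inv p h₂)
      1≤coeff : 1 ≤ coeff p S w
      1≤coeff = ≤-trans (≤-reflexive (sym (ind-T (Equivalence.from T-∧ (h₁∈S , Equivalence.from T-∧ (h₂∈S , ≡⇒== {w} refl))))))
                  (≤-trans (term≤ΣG (λ v → ind p (S h₁ ∧ (S v ∧ _==_ p (mul p h₁ (inv p v)) w))) h₂ h₂-valid)
                           (term≤ΣG (λ u → ΣG (λ v → ind p (S u ∧ (S v ∧ _==_ p (mul p u (inv p v)) w)))) h₁ h₁-valid))
      in-N⇒0 : ∀ {b} → T b → (if b then 0 else l) ≡ 0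
      in-N⇒0 {true} _ = refl
      coeff≡0 : coeff p S w ≡ 0
      coeff≡0 = trans (IsRDS.product rds w (mul-valid h₁ (inv p h₂))) (cong₂ _+_ (cong (λ b → if b then k else 0) w==e) (in-N⇒0 w∈N))

    semiregular : ∀ {S N m n k l K} → IsRDS p S N m n k l → CosetLabelling N K → card p S ≡ K → Semiregular p S N
    semiregular {S} {N} {K = K} rds L card-S g g-valid = begin
      card p (λ h → S h ∧ N (mul p h (inv p g)))    ≡⟨ ΣG-cong (λ h h-valid → trans (ind-∧ (S h) _) (cong (ind p (S h) *_) (cong (ind p) (T-ext
                                                         (λ h∈Ng → ≡⇒≡ᵇ _ _ (same-label h g h-valid g-valid h∈Ng))
                                                         (λ same → same-coset h g h-valid g-valid (≡ᵇ⇒≡ _ _ same)))))) ⟩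
      in-class (label g)                            ≡⟨ ∑-squeeze K in-class (λ _ → 1) in-class≤1 (≤-reflexive ∑-in-class) (label g) (label< g g-valid) ⟩
      1                                             ∎
      where
      open CosetLabelling L
      open ≡-Reasoning
      in-class : ℕ → ℕ
      in-class ℓ = ΣG (λ h → ind p (S h) * ind p (label h ≡ᵇ ℓ))
      in-class≤1 : ∀ ℓ → ℓ < K → in-class ℓ ≤ 1
      in-class≤1 ℓ _ = ΣG-≤1 _ (λ h _ → ind-*≤1 (S h) _) (λ h₁ h₂ h₁-valid h₂-valid pos₁ pos₂ →
        let h₁∈S , label₁ = ind-*-pos⇒T (S h₁) _ pos₁
            h₂∈S , label₂ = ind-*-pos⇒T (S h₂) _ pos₂
        in rds-at-most-one-in-coset rds h₁ h₂ h₁-valid h₂-valid h₁∈S h₂∈S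
             (same-coset h₁ h₂ h₁-valid h₂-valid (trans (≡ᵇ⇒≡ _ _ label₁) (sym (≡ᵇ⇒≡ _ _ label₂)))))
      one-label : ∀ h → Valid p h → ∑[ ℓ < K ] ind p (label h ≡ᵇ ℓ) ≡ 1
      one-label h h-valid = trans (∑-single K (label h) (label< h h-valid) (λ ℓ _ ℓ≢ → ind-¬T (λ same → ℓ≢ (sym (≡ᵇ⇒≡ _ _ same)))))
                                  (ind-T (≡⇒≡ᵇ (label h) (label h) refl))
      ∑-in-class : ∑[ ℓ < K ] 1 ≡ ∑ K in-class
      ∑-in-class = begin
        ∑[ ℓ < K ] 1                                              ≡⟨ trans (∑-const K 1) (*-identityʳ K) ⟩
        K                                                         ≡⟨ card-S ⟨
        ΣG (λ h → ind p (S h))                                    ≡⟨ ΣG-cong (λ h h-valid → trans (sym (*-identityʳ _)) (cong (ind p (S h) *_) (sym (one-label h h-valid)))) ⟩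
        ΣG (λ h → ind p (S h) * ∑[ ℓ < K ] ind p (label h ≡ᵇ ℓ))   ≡⟨ ΣG-cong (λ h _ → sym (∑-distribˡ-* K (ind p (S h)) _)) ⟩
        ΣG (λ h → ∑[ ℓ < K ] (ind p (S h) * ind p (label h ≡ᵇ ℓ))) ≡⟨ ΣG-∑-comm K _ ⟩
        ∑ K in-class                                              ∎

module CosetLabels where

  open import Data.Nat.Base as ℕ using (ℕ; NonZero; _%_; _<_; _∸_)
  import Data.Nat.Properties as ℕ
  import Data.Nat.DivMod as ℕ
  open import Data.Integer.Base hiding (NonZero; _%_; _<_; ∣_∣)
  open import Data.Integer.Properties using (pos-+; pos-*; +-comm; +-inverseʳ)
  open import Data.Integer.Divisibility.Signed
  open import Data.Integer.Tactic.RingSolver using (solve-∀)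
  open import Data.Product.Base using (_×_; _,_; proj₁; proj₂)
  open import Relation.Binary.PropositionalEquality
  open import Defs
  open Congruence
  open GroupArithmetic
  open SumsOverG
  open Subgroups
  open Semiregularity

  module CosetLabels (p : ℕ) .{{_ : NonZero p}} where

    open Arithmetic p
    open Sums p
    open Subgroups.Subgroups p
    open Semiregularity.Semiregularity p

    coords-quotient : ∀ h g → Valid p g →
      Coords (mul p h (inv p g)) (+ proj₁ h + - + proj₁ g * (1ℤ - + proj₂ g * P) * (1ℤ + + proj₂ h * P)) (+ proj₂ h + - + proj₂ g)
    coords-quotient h g g-valid = coords-mul (coords-self h) (coords-inv g-valid (coords-self g))

    Z-label : G p → ℕ
    Z-label (a , b) = b ℕ.* p ℕ.+ a % p

    private
      Z-label≡%-mod : ∀ a b → + Z-label (a , b) ≡ + a mod P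
      Z-label≡%-mod a b = ≡-mod-trans (≡-mod-multiple (+ b) (trans (pos-+ (b ℕ.* p) (a % p)) (trans (+-comm (+ (b ℕ.* p)) (+ (a % p))) (cong (_+_ (+ (a % p))) (pos-* b p)))))
                                     (%p≡ a)

      Z-label-injective : ∀ a₁ b₁ a₂ b₂ → b₁ < p → b₂ < p → Z-label (a₁ , b₁) ≡ Z-label (a₂ , b₂) →
                          a₁ % p ≡ a₂ % p × b₁ ≡ b₂
      Z-label-injective a₁ b₁ a₂ b₂ b₁<p b₂<p same = r₁≡r₂ ,
        ℕ.*-cancelʳ-≡ b₁ b₂ p (ℕ.+-cancelʳ-≡ (a₁ % p) _ _ (trans same (cong (b₂ ℕ.* p ℕ.+_) (sym r₁≡r₂))))
        where
        r₁≡r₂ : a₁ % p ≡ a₂ % p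
        r₁≡r₂ = ≡-mod⇒≡ (ℕ.m%n<n a₁ p) (ℕ.m%n<n a₂ p)
          (≡-mod-trans (%p≡ a₁) (≡-mod-trans (≡-mod-sym (Z-label≡%-mod a₁ b₁))
            (≡-mod-trans (≡-mod-reflexive (cong +_ same)) (≡-mod-trans (Z-label≡%-mod a₂ b₂) (≡-mod-sym (%p≡ a₂))))))

    Z-labelling : CosetLabelling (Zsub p) (p ℕ.* p)
    Z-labelling = record
      { label      = Z-label
      ; label<     = λ { (a , b) (_ , b<p) → ℕ.<-≤-trans (ℕ.+-monoʳ-< (b ℕ.* p) (ℕ.m%n<n a p))
                                                (ℕ.≤-trans (ℕ.≤-reflexive (ℕ.+-comm (b ℕ.* p) p)) (ℕ.*-monoˡ-≤ p b<p)) }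
      ; same-label = same-label
      ; same-coset = same-coset
      }
      where
      a₁-a₂≡first : ∀ a₁ b₁ a₂ b₂ → + a₁ - + a₂ ≡ + a₁ + - + a₂ * (1ℤ - + b₂ * P) * (1ℤ + + b₁ * P) mod P
      a₁-a₂≡first a₁ b₁ a₂ b₂ = ≡-mod-multiple (+ a₂ * (+ b₁ - + b₂) - + a₂ * + b₂ * + b₁ * P) (identity (+ a₁) (+ a₂) (+ b₁) (+ b₂) P)
        where identity : ∀ a₁ a₂ b₁ b₂ x → a₁ - a₂ ≡ a₁ + - a₂ * (1ℤ - b₂ * x) * (1ℤ + b₁ * x) + (a₂ * (b₁ - b₂) - a₂ * b₂ * b₁ * x) * x
              identity = solve-∀
      same-label : ∀ h g → Valid p h → Valid p g → mul p h (inv p g) ∈ Zsub p → Z-label h ≡ Z-label g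
      same-label h@(a₁ , b₁) g@(a₂ , b₂) (_ , b₁<p) g-valid@(_ , b₂<p) w∈Z = cong₂ (λ b r → b ℕ.* p ℕ.+ r) b₁≡b₂ r₁≡r₂
        where
        P∣A×P∣B = coords-∈Z (mul-valid h (inv p g)) (coords-quotient h g g-valid) w∈Z
        b₁≡b₂ : b₁ ≡ b₂
        b₁≡b₂ = ≡-mod⇒≡ b₁<p b₂<p (≡-mod (proj₂ P∣A×P∣B))
        r₁≡r₂ : a₁ % p ≡ a₂ % p
        r₁≡r₂ = ≡-mod⇒≡ (ℕ.m%n<n a₁ p) (ℕ.m%n<n a₂ p) (≡-mod-trans (%p≡ a₁)
          (≡-mod-trans (≡-mod (≡-mod-∣ (≡-mod-sym (a₁-a₂≡first a₁ b₁ a₂ b₂)) (proj₁ P∣A×P∣B))) (≡-mod-sym (%p≡ a₂))))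
      same-coset : ∀ h g → Valid p h → Valid p g → Z-label h ≡ Z-label g → mul p h (inv p g) ∈ Zsub p
      same-coset h@(a₁ , b₁) g@(a₂ , b₂) (_ , b₁<p) g-valid@(_ , b₂<p) same =
        coords-∈Z⁻ (mul-valid h (inv p g)) (coords-quotient h g g-valid)
          (≡-mod-∣ (a₁-a₂≡first a₁ b₁ a₂ b₂) (∣-difference (≡-mod-trans (≡-mod-sym (%p≡ a₁))
            (≡-mod-trans (≡-mod-reflexive (cong +_ (proj₁ decoded))) (%p≡ a₂)))))
          (subst (λ b → P ∣ + b₁ - + b) (proj₂ decoded) (subst (P ∣_) (sym (+-inverseʳ (+ b₁))) (∣n⇒∣m*n 0ℤ ∣-refl)))
        where decoded = Z-label-injective a₁ b₁ a₂ b₂ b₁<p b₂<p same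

    Y-label : G p → ℕ
    Y-label (a , b) = (a ℕ.* (1 ℕ.+ p ℕ.* (p ∸ b))) % (p ℕ.* p)

    private
      Y-label≡ : ∀ a b → b ℕ.≤ p → + Y-label (a , b) ≡ + a * (1ℤ - + b * P) mod P²
      Y-label≡ a b b≤p = ≡-mod-trans (%p²≡ _) (≡-mod-multiple (+ a) (begin
        + (a ℕ.* (1 ℕ.+ p ℕ.* (p ∸ b)))      ≡⟨ pos-* a _ ⟩
        + a * + (1 ℕ.+ p ℕ.* (p ∸ b))        ≡⟨ cong (+ a *_) (trans (pos-+ 1 _) (cong (_+_ 1ℤ) (trans (pos-* p (p ∸ b)) (cong (P *_) (∸≡- b≤p))))) ⟩
        + a * (1ℤ + P * (P - + b))            ≡⟨ identity (+ a) (+ b) P ⟩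
        + a * (1ℤ - + b * P) + + a * P²       ∎))
        where open ≡-Reasoning
              identity : ∀ a b x → a * (1ℤ + x * (x - b)) ≡ a * (1ℤ - b * x) + a * (x * x)
              identity = solve-∀

    Y-labelling : CosetLabelling (Ysub p) (p ℕ.* p)
    Y-labelling = record
      { label      = Y-label
      ; label<     = λ h _ → ℕ.m%n<n _ (p ℕ.* p)
      ; same-label = same-label
      ; same-coset = same-coset
      }
      where
      same-label : ∀ h g → Valid p h → Valid p g → mul p h (inv p g) ∈ Ysub p → Y-label h ≡ Y-label g
      same-label h@(a₁ , b₁) g@(a₂ , b₂) (_ , b₁<p) g-valid@(_ , b₂<p) w∈Y =
        ≡-mod-P²⇒≡ (ℕ.m%n<n _ (p ℕ.* p)) (ℕ.m%n<n _ (p ℕ.* p))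
          (≡-mod-trans (Y-label≡ a₁ b₁ (ℕ.<⇒≤ b₁<p)) (≡-mod-trans (≡-mod P²∣K₁-K₂) (≡-mod-sym (Y-label≡ a₂ b₂ (ℕ.<⇒≤ b₂<p)))))
        where
        P²∣A = ≡0-mod⇒∣ (coords-∈Y (mul-valid h (inv p g)) (coords-quotient h g g-valid) w∈Y)
        P²∣K₁-K₂ : P² ∣ + a₁ * (1ℤ - + b₁ * P) - + a₂ * (1ℤ - + b₂ * P)
        P²∣K₁-K₂ = ∣-lincomb₂ _ (1ℤ - + b₁ * P) (- (+ a₂ * (1ℤ - + b₂ * P) * + b₁ * + b₁)) P²∣A ∣-refl (identity (+ a₁) (+ a₂) (+ b₁) (+ b₂) P)
          where identity : ∀ a₁ a₂ b₁ b₂ x →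
                           a₁ * (1ℤ - b₁ * x) - a₂ * (1ℤ - b₂ * x)
                             ≡ (1ℤ - b₁ * x) * (a₁ + - a₂ * (1ℤ - b₂ * x) * (1ℤ + b₁ * x)) + (- (a₂ * (1ℤ - b₂ * x) * b₁ * b₁)) * (x * x)
                identity = solve-∀
      same-coset : ∀ h g → Valid p h → Valid p g → Y-label h ≡ Y-label g → mul p h (inv p g) ∈ Ysub p
      same-coset h@(a₁ , b₁) g@(a₂ , b₂) (_ , b₁<p) g-valid@(_ , b₂<p) same =
        coords-∈Y⁻ (mul-valid h (inv p g)) (coords-quotient h g g-valid)
          (∣⇒≡0-mod (∣-lincomb₂ _ (1ℤ + + b₁ * P) (+ a₁ * + b₁ * + b₁) (∣-difference K₁≡K₂) ∣-refl (identity (+ a₁) (+ a₂) (+ b₁) (+ b₂) P)))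
        where
        K₁≡K₂ : + a₁ * (1ℤ - + b₁ * P) ≡ + a₂ * (1ℤ - + b₂ * P) mod P²
        K₁≡K₂ = ≡-mod-trans (≡-mod-sym (Y-label≡ a₁ b₁ (ℕ.<⇒≤ b₁<p))) (≡-mod-trans (≡-mod-reflexive (cong +_ same)) (Y-label≡ a₂ b₂ (ℕ.<⇒≤ b₂<p)))
        identity : ∀ a₁ a₂ b₁ b₂ x →
                   a₁ + - a₂ * (1ℤ - b₂ * x) * (1ℤ + b₁ * x)
                     ≡ (1ℤ + b₁ * x) * (a₁ * (1ℤ - b₁ * x) - a₂ * (1ℤ - b₂ * x)) + (a₁ * b₁ * b₁) * (x * x)
        identity = solve-∀

module Teichmuller where

  open import Data.Nat.Base as ℕ using (ℕ; zero; suc; NonZero; _%_; _/_; _^_; _∸_; z<s; s<s)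
  import Data.Nat.Properties as ℕ
  import Data.Nat.DivMod as ℕ
  import Data.Nat.Divisibility as ℕ
  open import Data.Nat.Primality using (Prime; prime⇒nonTrivial)
  open import Data.Nat.Tactic.RingSolver as ℕ-Solver using ()
  open import Data.Integer.Base hiding (NonZero; _%_; _/_; _^_; _<_; suc; ∣_∣)
  open import Data.Integer.Properties using (pos-+; pos-*; *-identityʳ; *-identityˡ; *-assoc; *-comm; neg-involutive)
  open import Data.Integer.Divisibility.Signed
  open import Data.Integer.Tactic.RingSolver using (solve-∀)
  open import Data.Product.Base using (_×_; _,_; proj₁; proj₂; ∃-syntax)
  open import Data.Sum.Base using (_⊎_; inj₁; inj₂)
  open import Data.Empty using (⊥-elim)
  open import Relation.Binary.PropositionalEquality
  open import Relation.Nullary using (¬_; contradiction; yes; no)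
  open import Relation.Binary.Definitions using (tri<; tri≈; tri>)
  open import Defs
  open Congruence
  open GroupArithmetic

  module Teichmuller (p : ℕ) .{{_ : NonZero p}} (p-prime : Prime p) (p-odd : ¬ (2 ℕ.∣ p))
           (r : ℕ) (r-primitive : IsPrimitiveRootModp² p r) where

    open Arithmetic p

    1<p : 1 ℕ.< p
    1<p = ℕ.nonTrivial⇒n>1 p {{prime⇒nonTrivial p-prime}}

    q h : ℕ
    q = p ∸ 1
    h = p / 2

    p≡1+2h : p ≡ 1 ℕ.+ 2 ℕ.* h
    p≡1+2h = trans (ℕ.m≡m%n+[m/n]*n p 2) (cong₂ ℕ._+_ p%2≡1 (ℕ.*-comm (p / 2) 2))
      where
      p%2≡1 : p % 2 ≡ 1
      p%2≡1 with p % 2 in eq | ℕ.m%n<n p 2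
      ... | 0           | _ = ⊥-elim (p-odd (ℕ.m%n≡0⇒n∣m p 2 eq))
      ... | 1           | _ = refl
      ... | suc (suc _) | s<s (s<s ())

    q≡2h : q ≡ 2 ℕ.* h
    q≡2h = cong (_∸ 1) p≡1+2h

    q≡h+h : q ≡ h ℕ.+ h
    q≡h+h = trans q≡2h (cong (h ℕ.+_) (ℕ.+-identityʳ h))

    p≡1+q : p ≡ suc q
    p≡1+q = trans p≡1+2h (cong suc (sym q≡2h))

    0<h : 0 ℕ.< h
    0<h with h in h≡
    ... | zero  = ⊥-elim (ℕ.<-irrefl (sym (trans p≡1+2h (cong (λ x → 1 ℕ.+ 2 ℕ.* x) h≡))) 1<p)
    ... | suc _ = z<s

    H : ℤ
    H = + ((p ℕ.+ 1) / 2)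

    [p+1]/2≡1+h : (p ℕ.+ 1) / 2 ≡ suc h
    [p+1]/2≡1+h = trans (cong (λ n → (n ℕ.+ 1) / 2) p≡1+2h) (trans (cong (_/ 2) (identity h)) (ℕ.m*n/n≡m (suc h) 2))
      where identity : ∀ h → 1 ℕ.+ 2 ℕ.* h ℕ.+ 1 ≡ suc h ℕ.* 2
            identity = ℕ-Solver.solve-∀

    2H≡1 : + 2 * H ≡ 1ℤ mod P
    2H≡1 = ≡-mod-multiple 1ℤ (begin
      + 2 * H                            ≡⟨ sym (pos-* 2 ((p ℕ.+ 1) / 2)) ⟩
      + (2 ℕ.* ((p ℕ.+ 1) / 2))          ≡⟨ cong (λ n → + (2 ℕ.* n)) [p+1]/2≡1+h ⟩
      + (2 ℕ.* suc h)                    ≡⟨ cong +_ (identity h) ⟩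
      + (1 ℕ.+ (1 ℕ.+ 2 ℕ.* h))          ≡⟨ cong (λ n → + (1 ℕ.+ n)) (sym p≡1+2h) ⟩
      + (1 ℕ.+ p)                        ≡⟨ pos-+ 1 p ⟩
      1ℤ + P                             ≡⟨ cong (_+_ 1ℤ) (sym (*-identityˡ P)) ⟩
      1ℤ + 1ℤ * P                        ∎)
      where open ≡-Reasoning
            identity : ∀ h → 2 ℕ.* suc h ≡ 1 ℕ.+ (1 ℕ.+ 2 ℕ.* h)
            identity = ℕ-Solver.solve-∀

    ¬P∣small : ∀ n → 0 ℕ.< n → n ℕ.< p → ¬ (P ∣ + n)
    ¬P∣small (suc n) _ n<p P∣n = ℕ.<-irrefl refl (ℕ.<-≤-trans n<p (ℕ.∣⇒≤ (∣⇒∣ᵤ P∣n)))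

    ¬P∣1 : ¬ (P ∣ 1ℤ)
    ¬P∣1 = ¬P∣small 1 z<s 1<p

    ¬P∣2 : ¬ (P ∣ + 2)
    ¬P∣2 P∣2 with ℕ.≤-antisym (ℕ.∣⇒≤ (∣⇒∣ᵤ P∣2)) 1<p
    ... | refl = p-odd (∣⇒∣ᵤ P∣2)

    ¬P∣H : ¬ (P ∣ H)
    ¬P∣H P∣H = ¬P∣1 (≡-mod-∣ 2H≡1 (∣n⇒∣m*n (+ 2) P∣H))

    ¬P∣1-H : ¬ (P ∣ 1ℤ - H)
    ¬P∣1-H P∣1-H = ¬P∣1 (subst (P ∣_) (identity H) (∣m∣n⇒∣m+n (∣n⇒∣m*n (+ 2) P∣1-H) (∣-difference 2H≡1)))
      where identity : ∀ h → + 2 * (1ℤ - h) + (+ 2 * h - 1ℤ) ≡ 1ℤ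
            identity = solve-∀

    euclidsLemma-P : ∀ a b → P ∣ a * b → P ∣ a ⊎ P ∣ b
    euclidsLemma-P a b = euclidsLemmaℤ a b p-prime

    euclidsLemma-P² : ∀ a b → ¬ (P ∣ a) → P² ∣ a * b → P² ∣ b
    euclidsLemma-P² a b P∤a P²∣ab with euclidsLemma-P a b (∣-trans (∣m⇒∣m*n P ∣-refl) P²∣ab)
    ... | inj₁ P∣a = contradiction P∣a P∤a
    ... | inj₂ (divides k refl) with euclidsLemma-P a k (*-cancelʳ-∣ P (subst (P² ∣_) (sym (*-assoc a k P)) P²∣ab))
    ...   | inj₁ P∣a = contradiction P∣a P∤a
    ...   | inj₂ P∣k = *-monoˡ-∣ P P∣k

    P∣abc⇒P∣c : ∀ a b c → P ∣ a * b * c → ¬ (P ∣ a) → ¬ (P ∣ b) → P ∣ c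
    P∣abc⇒P∣c a b c P∣abc P∤a P∤b with euclidsLemma-P (a * b) c P∣abc
    ... | inj₂ P∣c = P∣c
    ... | inj₁ P∣ab with euclidsLemma-P a b P∣ab
    ...   | inj₁ P∣a = contradiction P∣a P∤a
    ...   | inj₂ P∣b = contradiction P∣b P∤b

    1<p² : 1 ℕ.< p ℕ.* p
    1<p² = ℕ.<-≤-trans 1<p (ℕ.m≤m*n p p)

    0<p* : ∀ {m} → 0 ℕ.< m → 0 ℕ.< p ℕ.* m
    0<p* {m} 0<m = subst (ℕ._< p ℕ.* m) (ℕ.*-zeroʳ p) (ℕ.*-monoʳ-< p 0<m)

    r^pq≡1 : + (r ^ (p ℕ.* q)) ≡ 1ℤ mod P²
    r^pq≡1 = ≡-mod-trans (≡-mod-sym (%p²≡ _)) (≡-mod-reflexive (cong +_ (proj₁ r-primitive)))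

    r^k≢1 : ∀ k → 0 ℕ.< k → k ℕ.< p ℕ.* q → ¬ (+ (r ^ k) ≡ 1ℤ mod P²)
    r^k≢1 k 0<k k<pq r^k≡1 =
      proj₂ r-primitive k 0<k k<pq (≡-mod-P²⇒≡ (ℕ.m%n<n _ (p ℕ.* p)) 1<p² (≡-mod-trans (%p²≡ _) r^k≡1))

    ^-≡-1+n[a-1] : ∀ a n → + a ≡ 1ℤ mod P → + (a ^ n) ≡ 1ℤ + + n * (+ a - 1ℤ) mod P²
    ^-≡-1+n[a-1] a zero    _ = ≡-mod-reflexive (identity (+ a))
      where identity : ∀ a → 1ℤ ≡ 1ℤ + 0ℤ * (a - 1ℤ)
            identity = solve-∀
    ^-≡-1+n[a-1] a (suc n) a≡1@(≡-mod (divides k a-1≡kP)) = ≡-mod-trans (≡-mod-reflexive (pos-* a (a ^ n)))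
      (≡-mod-trans (≡-mod-* (≡-mod-refl {a = + a}) (^-≡-1+n[a-1] a n a≡1))
        (≡-mod-multiple (+ n * k * k) (trans (identity (+ a) (+ n) k P a-1≡kP)
          (cong (λ m → 1ℤ + m * (+ a - 1ℤ) + + n * k * k * P²) (sym (pos-+ 1 n))))))
      where identity : ∀ a n k x → a - 1ℤ ≡ k * x →
                       a * (1ℤ + n * (a - 1ℤ)) ≡ 1ℤ + (1ℤ + n) * (a - 1ℤ) + n * k * k * (x * x)
            identity a n k x a-1≡kx = begin
              a * (1ℤ + n * (a - 1ℤ))                                   ≡⟨ expand a n ⟩
              1ℤ + (1ℤ + n) * (a - 1ℤ) + n * (a - 1ℤ) * (a - 1ℤ)        ≡⟨ cong (λ d → 1ℤ + (1ℤ + n) * (a - 1ℤ) + n * d * d) a-1≡kx ⟩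
              1ℤ + (1ℤ + n) * (a - 1ℤ) + n * (k * x) * (k * x)          ≡⟨ regroup n k x (1ℤ + (1ℤ + n) * (a - 1ℤ)) ⟩
              1ℤ + (1ℤ + n) * (a - 1ℤ) + n * k * k * (x * x)            ∎
              where open ≡-Reasoning
                    expand : ∀ a n → a * (1ℤ + n * (a - 1ℤ)) ≡ 1ℤ + (1ℤ + n) * (a - 1ℤ) + n * (a - 1ℤ) * (a - 1ℤ)
                    expand = solve-∀
                    regroup : ∀ n k x c → c + n * (k * x) * (k * x) ≡ c + n * k * k * (x * x)
                    regroup = solve-∀

    ^p≡1 : ∀ a → + a ≡ 1ℤ mod P → + (a ^ p) ≡ 1ℤ mod P²
    ^p≡1 a a≡1@(≡-mod (divides k a-1≡kP)) = ≡-mod-trans (^-≡-1+n[a-1] a p a≡1)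
      (≡-mod-multiple k (trans (cong (λ d → 1ℤ + P * d) a-1≡kP) (identity k P)))
      where identity : ∀ k x → 1ℤ + x * (k * x) ≡ 1ℤ + k * (x * x)
            identity = solve-∀

    τ : ℕ → ℕ
    τ j = (ξ p r ^ j) % (p ℕ.* p)

    ω : ℕ → ℤ
    ω j = + τ j

    ω≡ξ^j : ∀ j → ω j ≡ + (ξ p r ^ j) mod P²
    ω≡ξ^j j = %p²≡ (ξ p r ^ j)

    ξ^[m+n] : ∀ m n → + (ξ p r ^ (m ℕ.+ n)) ≡ + (ξ p r ^ m) * + (ξ p r ^ n)
    ξ^[m+n] m n = trans (cong +_ (ℕ.^-distribˡ-+-* (ξ p r) m n)) (pos-* (ξ p r ^ m) (ξ p r ^ n))

    ξ^q≡1 : + (ξ p r ^ q) ≡ 1ℤ mod P²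
    ξ^q≡1 = ≡-mod-trans (≡-mod-reflexive (cong +_ (ℕ.^-*-assoc r p q))) r^pq≡1

    ξ^j*ξ^[q∸j]≡1 : ∀ j → j ℕ.≤ q → + (ξ p r ^ j) * + (ξ p r ^ (q ∸ j)) ≡ 1ℤ mod P²
    ξ^j*ξ^[q∸j]≡1 j j≤q =
      ≡-mod-trans (≡-mod-reflexive (trans (sym (ξ^[m+n] j (q ∸ j))) (cong (λ n → + (ξ p r ^ n)) (ℕ.m+[n∸m]≡n j≤q)))) ξ^q≡1

    ¬P∣ω : ∀ j → j ℕ.< q → ¬ (P ∣ ω j)
    ¬P∣ω j j<q P∣ωj = ¬P∣1 (≡-mod-∣ (≡-mod-P²⇒P (ξ^j*ξ^[q∸j]≡1 j (ℕ.<⇒≤ j<q)))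
      (∣m⇒∣m*n (+ (ξ p r ^ (q ∸ j))) (≡-mod-∣ (≡-mod-P²⇒P (ω≡ξ^j j)) P∣ωj)))

    ξ^m≢1 : ∀ m → 0 ℕ.< m → m ℕ.< q → ¬ (+ (ξ p r ^ m) ≡ 1ℤ mod P)
    ξ^m≢1 m 0<m m<q ξ^m≡1 = r^k≢1 (p ℕ.* m) (0<p* 0<m) (ℕ.*-monoʳ-< p m<q) (begin
      + (r ^ (p ℕ.* m))                                  ≈⟨ ≡-mod-reflexive (sym (*-identityʳ _)) ⟩
      + (r ^ (p ℕ.* m)) * 1ℤ                             ≈⟨ ≡-mod-* (≡-mod-refl {a = + (r ^ (p ℕ.* m))}) (≡-mod-sym (≡-mod-trans (≡-mod-^ m r^pq≡1) (≡-mod-reflexive (cong +_ (ℕ.^-zeroˡ m))))) ⟩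
      + (r ^ (p ℕ.* m)) * + ((r ^ (p ℕ.* q)) ^ m)        ≈⟨ ≡-mod-reflexive (sym (pos-* (r ^ (p ℕ.* m)) _)) ⟩
      + (r ^ (p ℕ.* m) ℕ.* (r ^ (p ℕ.* q)) ^ m)          ≈⟨ ≡-mod-reflexive (cong +_ (sym ξ^mp≡)) ⟩
      + ((ξ p r ^ m) ^ p)                                ≈⟨ ^p≡1 (ξ p r ^ m) ξ^m≡1 ⟩
      1ℤ                                                 ∎)
      where
      open import Relation.Binary.Reasoning.Setoid (≡-mod-setoid {P²})
      ξ^mp≡ : (ξ p r ^ m) ^ p ≡ r ^ (p ℕ.* m) ℕ.* (r ^ (p ℕ.* q)) ^ m
      ξ^mp≡ = ≡.begin
        (ξ p r ^ m) ^ p                         ≡.≡⟨ cong (_^ p) (ℕ.^-*-assoc r p m) ⟩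
        (r ^ (p ℕ.* m)) ^ p                     ≡.≡⟨ ℕ.^-*-assoc r (p ℕ.* m) p ⟩
        r ^ (p ℕ.* m ℕ.* p)                     ≡.≡⟨ cong (λ n → r ^ (p ℕ.* m ℕ.* n)) p≡1+q ⟩
        r ^ (p ℕ.* m ℕ.* suc q)                 ≡.≡⟨ cong (r ^_) (identity p m q) ⟩
        r ^ (p ℕ.* m ℕ.+ p ℕ.* q ℕ.* m)          ≡.≡⟨ ℕ.^-distribˡ-+-* r (p ℕ.* m) _ ⟩
        r ^ (p ℕ.* m) ℕ.* r ^ (p ℕ.* q ℕ.* m)   ≡.≡⟨ cong (r ^ (p ℕ.* m) ℕ.*_) (sym (ℕ.^-*-assoc r (p ℕ.* q) m)) ⟩
        r ^ (p ℕ.* m) ℕ.* (r ^ (p ℕ.* q)) ^ m   ≡.∎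
        where module ≡ = ≡-Reasoning
              identity : ∀ p m q → p ℕ.* m ℕ.* suc q ≡ p ℕ.* m ℕ.+ p ℕ.* q ℕ.* m
              identity = ℕ-Solver.solve-∀

    private
      ω-injective-< : ∀ j j′ → j ℕ.< j′ → j′ ℕ.< q → ¬ (ω j ≡ ω j′ mod P)
      ω-injective-< j j′ j<j′ j′<q ωj≡ωj′ = ξ^m≢1 m 0<m m<q (begin
        + (ξ p r ^ m)                                   ≈⟨ ≡-mod-reflexive (ξ^[m+n] j (q ∸ j′)) ⟩
        + (ξ p r ^ j) * + (ξ p r ^ (q ∸ j′))             ≈⟨ ≡-mod-* ξ^j≡ξ^j′ ≡-mod-refl ⟩
        + (ξ p r ^ j′) * + (ξ p r ^ (q ∸ j′))            ≈⟨ ≡-mod-P²⇒P (ξ^j*ξ^[q∸j]≡1 j′ (ℕ.<⇒≤ j′<q)) ⟩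
        1ℤ                                               ∎)
        where
        open import Relation.Binary.Reasoning.Setoid (≡-mod-setoid {P})
        m = j ℕ.+ (q ∸ j′)
        0<m : 0 ℕ.< m
        0<m = ℕ.<-≤-trans (ℕ.m<n⇒0<n∸m j′<q) (ℕ.m≤n+m (q ∸ j′) j)
        m<q : m ℕ.< q
        m<q = ℕ.<-≤-trans (ℕ.+-monoˡ-< (q ∸ j′) j<j′) (ℕ.≤-reflexive (ℕ.m+[n∸m]≡n (ℕ.<⇒≤ j′<q)))
        ξ^j≡ξ^j′ : + (ξ p r ^ j) ≡ + (ξ p r ^ j′) mod P
        ξ^j≡ξ^j′ = ≡-mod-trans (≡-mod-sym (≡-mod-P²⇒P (ω≡ξ^j j))) (≡-mod-trans ωj≡ωj′ (≡-mod-P²⇒P (ω≡ξ^j j′)))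

    ω-injective : ∀ j j′ → j ℕ.< q → j′ ℕ.< q → ω j ≡ ω j′ mod P → j ≡ j′
    ω-injective j j′ j<q j′<q ωj≡ωj′ with ℕ.<-cmp j j′
    ... | tri≈ _ j≡j′ _ = j≡j′
    ... | tri< j<j′ _ _ = contradiction ωj≡ωj′ (ω-injective-< j j′ j<j′ j′<q)
    ... | tri> _ _ j>j′ = contradiction (≡-mod-sym ωj≡ωj′) (ω-injective-< j′ j j>j′ j<q)

    private
      W : ℤ
      W = + (ξ p r ^ h)

      P²∣[W-1][W+1] : P² ∣ (W - 1ℤ) * (W + 1ℤ)
      P²∣[W-1][W+1] = subst (P² ∣_) (identity W) (∣-difference (≡-mod-trans (≡-mod-reflexive (sym (ξ^[m+n] h h)))
                        (≡-mod-trans (≡-mod-reflexive (cong (λ n → + (ξ p r ^ n)) (sym q≡h+h))) ξ^q≡1)))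
        where identity : ∀ w → w * w - 1ℤ ≡ (w - 1ℤ) * (w + 1ℤ)
              identity = solve-∀

      h<q : h ℕ.< q
      h<q = ℕ.<-≤-trans (ℕ.m<m+n h 0<h) (ℕ.≤-reflexive (sym q≡h+h))

      ¬P∣W-1 : ¬ (P ∣ W - 1ℤ)
      ¬P∣W-1 P∣W-1 = r^k≢1 (p ℕ.* h) (0<p* 0<h) (ℕ.*-monoʳ-< p h<q)
        (≡-mod-trans (≡-mod-reflexive (cong +_ (sym (ℕ.^-*-assoc r p h))))
          (≡-mod (euclidsLemma-P² (W + 1ℤ) (W - 1ℤ) ¬P∣W+1 (subst (P² ∣_) (*-comm (W - 1ℤ) _) P²∣[W-1][W+1]))))
        where
        ¬P∣W+1 : ¬ (P ∣ W + 1ℤ)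
        ¬P∣W+1 P∣W+1 = ¬P∣2 (subst (P ∣_) (identity W) (∣m∣n⇒∣m-n P∣W+1 P∣W-1))
          where identity : ∀ w → (w + 1ℤ) - (w - 1ℤ) ≡ + 2
                identity = solve-∀

    ξ^h≡-1 : + (ξ p r ^ h) ≡ - 1ℤ mod P²
    ξ^h≡-1 = ≡-mod (subst (P² ∣_) (identity W) (euclidsLemma-P² (W - 1ℤ) (W + 1ℤ) ¬P∣W-1 P²∣[W-1][W+1]))
      where identity : ∀ w → w + 1ℤ ≡ w - (- 1ℤ)
            identity = solve-∀

    ω[j+h]≡-ω : ∀ j → ω (j ℕ.+ h) ≡ - ω j mod P²
    ω[j+h]≡-ω j = begin
      ω (j ℕ.+ h)                       ≈⟨ ω≡ξ^j (j ℕ.+ h) ⟩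
      + (ξ p r ^ (j ℕ.+ h))             ≡⟨ ξ^[m+n] j h ⟩
      + (ξ p r ^ j) * + (ξ p r ^ h)     ≈⟨ ≡-mod-* (≡-mod-sym (ω≡ξ^j j)) ξ^h≡-1 ⟩
      ω j * - 1ℤ                        ≡⟨ identity (ω j) ⟩
      - ω j                             ∎
      where open import Relation.Binary.Reasoning.Setoid (≡-mod-setoid {P²})
            identity : ∀ t → t * - 1ℤ ≡ - t
            identity = solve-∀

    ω-neg : ∀ j → j ℕ.< q → ∃[ j′ ] (j′ ℕ.< q × ω j′ ≡ - ω j mod P²)
    ω-neg j j<q with ℕ.<-≤-connex j h
    ... | inj₁ j<h = j ℕ.+ h , ℕ.<-≤-trans (ℕ.+-monoˡ-< h j<h) (ℕ.≤-reflexive (sym q≡h+h)) , ω[j+h]≡-ω j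
    ... | inj₂ h≤j = j ∸ h , ℕ.≤-<-trans (ℕ.m∸n≤m j h) j<q ,
      ≡-mod-trans (≡-mod-reflexive (sym (neg-involutive (ω (j ∸ h)))))
        (≡-mod-neg (≡-mod-sym (subst (λ n → ω n ≡ - ω (j ∸ h) mod P²) (ℕ.m∸n+n≡m h≤j) (ω[j+h]≡-ω (j ∸ h)))))

module XSet where

  open import Data.Nat.Base as ℕ using (ℕ; NonZero; _%_; _<_)
  import Data.Nat.Properties as ℕ
  open import Data.Nat.Divisibility as ℕ using ()
  open import Data.Nat.Primality using (Prime)
  open import Data.Integer.Base hiding (NonZero; _%_; _<_)
  open import Data.Integer.Properties using (pos-*)
  open import Data.Integer.DivMod using (n%ℕd<d)
  open import Data.Integer.Divisibility.Signed using (_∣_)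
  open import Data.Integer.Tactic.RingSolver using (solve-∀)
  open import Data.Bool.Base using (Bool; T)
  open import Data.List.Base using (map; upTo)
  open import Data.List.Relation.Unary.Any using (Any)
  open import Data.List.Relation.Unary.Any.Properties using (any⁺; any⁻; applyUpTo⁺; applyUpTo⁻; map⁺; map⁻; concatMap⁺; concatMap⁻)
  open import Data.Product.Base using (_×_; _,_; proj₁; ∃-syntax)
  open import Function.Base using (id; _∘_)
  open import Relation.Binary.PropositionalEquality
  open import Relation.Nullary using (¬_)
  open import Defs
  open Congruence
  open GroupArithmetic
  open SumsOverG
  open Teichmuller

  module XSet (p : ℕ) .{{_ : NonZero p}} (p-prime : Prime p) (p-odd : ¬ (2 ℕ.∣ p))
              (r : ℕ) (r-primitive : IsPrimitiveRootModp² p r) (i : ℕ) where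

    open Arithmetic p
    open Sums p
    open Teichmuller.Teichmuller p p-prime p-odd r r-primitive

    x₀ : ℕ → ℕ → G p
    x₀ α β = mul p (mul p (pow p (gx p) α) (pow p (gy p) β)) (pow p (gz p) (half p (η p α ℕ.* β)))

    ψ : ℕ → ℕ → G p
    ψ j β = mul p (x₀ (τ j) β) (pow p (gy p) i)

    coords-ψ : ∀ j β → Coords (ψ j β) (ω j * (1ℤ + P * + β * H)) (+ β + + i)
    coords-ψ j β = coords-cong
      (coords-mul (coords-mul (coords-mul (coords-pow-gx (τ j)) (coords-pow-gy β)) (coords-pow-gz k)) (coords-pow-gy i))
      (begin
        (ω j + 0ℤ * (1ℤ + 0ℤ * P)) + (+ k * P) * (1ℤ + (0ℤ + + β) * P) + 0ℤ * (1ℤ + ((0ℤ + + β) + 0ℤ) * P)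
                                           ≈⟨ ≡-mod-multiple (+ k * + β) (expand (ω j) (+ k) (+ β) P) ⟩
        ω j + P * + k                      ≈⟨ ≡-mod-+ (≡-mod-refl {a = ω j}) (≡-mod-scale P k≡) ⟩
        ω j + P * (ω j * + β * H)          ≡⟨ factor (ω j) (+ β) H P ⟩
        ω j * (1ℤ + P * + β * H)           ∎)
      (≡-mod-reflexive (simplify (+ β) (+ i)))
      where
      open import Relation.Binary.Reasoning.Setoid (≡-mod-setoid {P²})
      k = half p (η p (τ j) ℕ.* β)
      k≡ : + k ≡ ω j * + β * H mod P
      k≡ = ≡-mod-trans (%p≡ _)
        (≡-mod-trans (≡-mod-reflexive (trans (pos-* (τ j % p ℕ.* β) _) (cong (_* H) (pos-* (τ j % p) β))))
          (≡-mod-* (≡-mod-* (%p≡ (τ j)) ≡-mod-refl) ≡-mod-refl))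
      expand : ∀ t k b x → (t + 0ℤ * (1ℤ + 0ℤ * x)) + (k * x) * (1ℤ + (0ℤ + b) * x) + 0ℤ * (1ℤ + ((0ℤ + b) + 0ℤ) * x)
                           ≡ (t + x * k) + (k * b) * (x * x)
      expand = solve-∀
      factor : ∀ t b h x → t + x * (t * b * h) ≡ t * (1ℤ + x * b * h)
      factor = solve-∀
      simplify : ∀ b i → (0ℤ + b) + 0ℤ + i ≡ b + i
      simplify = solve-∀

    ψ∈X : ∀ j β → j < q → β < p → ψ j β ∈ Xi p r i
    ψ∈X j β j<q β<p = any⁺ (λ u → _==_ p (mul p u (pow p (gy p) i)) (ψ j β))
      (concatMap⁺ (λ α → map (x₀ α) (upTo p)) (map⁺ (applyUpTo⁺ id (map⁺ (applyUpTo⁺ id (≡⇒== {ψ j β} refl) β<p)) j<q)))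

    ∈X⇒ : ∀ v → v ∈ Xi p r i → ∃[ j ] ∃[ β ] (j < q × β < p × ψ j β ≡ v)
    ∈X⇒ v v∈X = from-row (applyUpTo⁻ id (map⁻ (concatMap⁻ _ (any⁻ hits-v (X0list p r) v∈X))))
      where
      hits-v : G p → Bool
      hits-v u = _==_ p (mul p u (pow p (gy p) i)) v
      from-row : ∃[ j ] (j < q × Any (T ∘ hits-v) (map (x₀ (τ j)) (upTo p))) → ∃[ j ] ∃[ β ] (j < q × β < p × ψ j β ≡ v)
      from-row (j , j<q , in-row) with applyUpTo⁻ id (map⁻ in-row)
      ... | β , β<p , ψ==v = j , β , j<q , β<p , ==⇒≡ ψ==v

    ψ-injective : ∀ j β j′ β′ → j < q → β < p → j′ < q → β′ < p → ψ j β ≡ ψ j′ β′ → j ≡ j′ × β ≡ β′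
    ψ-injective j β j′ β′ j<q β<p j′<q β′<p ψ≡ψ′ = ω-injective j j′ j<q j′<q ωj≡ωj′ , ≡-mod⇒≡ β<p β′<p β≡β′
      where
      open import Relation.Binary.Reasoning.Setoid (≡-mod-setoid {P})
      c′ = subst (λ g → Coords g (ω j′ * (1ℤ + P * + β′ * H)) (+ β′ + + i)) (sym ψ≡ψ′) (coords-ψ j′ β′)
      same-first : ω j * (1ℤ + P * + β * H) ≡ ω j′ * (1ℤ + P * + β′ * H) mod P
      same-first = ≡-mod-P²⇒P (≡-mod-trans (≡-mod-sym (first (coords-ψ j β))) (first c′))
      ωj≡ωj′ = begin
        ω j                           ≈⟨ ≡-mod-multiple (- (ω j * + β * H)) (reduce (ω j) (+ β) H P) ⟩
        ω j * (1ℤ + P * + β * H)      ≈⟨ same-first ⟩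
        ω j′ * (1ℤ + P * + β′ * H)    ≈⟨ ≡-mod-multiple (ω j′ * + β′ * H) (expand (ω j′) (+ β′) H P) ⟩
        ω j′                          ∎
        where reduce : ∀ t b h x → t ≡ t * (1ℤ + x * b * h) + (- (t * b * h)) * x
              reduce = solve-∀
              expand : ∀ t b h x → t * (1ℤ + x * b * h) ≡ t + (t * b * h) * x
              expand = solve-∀
      β≡β′ = begin
        + β                 ≡⟨ add-sub (+ β) (+ i) ⟩
        (+ β + + i) - + i   ≈⟨ ≡-mod-+ (≡-mod-trans (≡-mod-sym (second (coords-ψ j β))) (second c′)) (≡-mod-refl {a = - + i}) ⟩
        (+ β′ + + i) - + i  ≡⟨ add-sub (+ β′) (+ i) ⟨
        + β′                ∎
        where add-sub : ∀ b i → b ≡ (b + i) - i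
              add-sub = solve-∀

    X-parametrisation : Parametrisation (Xi p r i) q p
    X-parametrisation = record
      { point     = ψ
      ; valid     = λ j β _ _ → mul-valid (x₀ (τ j) β) (pow p (gy p) i)
      ; member    = ψ∈X
      ; onto      = λ v _ → ∈X⇒ v
      ; injective = ψ-injective
      }

    record InX (A B : ℤ) : Set where
      constructor inX
      field
        row       : ℕ
        row<q     : row < q
        first≡row : A ≡ ω row * (1ℤ + P * (B - + i) * H) mod P²

    coords-ψ⇒InX : ∀ {j β w A B} → Coords w (ω j * (1ℤ + P * + β * H)) (+ β + + i) → Coords w A B →
                   A ≡ ω j * (1ℤ + P * (B - + i) * H) mod P²
    coords-ψ⇒InX {j} {β} {w} {A} {B} ψ-coords w-coords = begin
      A                              ≈⟨ ≡-mod-sym (first w-coords) ⟩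
      + proj₁ w                      ≈⟨ first ψ-coords ⟩
      ω j * (1ℤ + P * + β * H)       ≈⟨ ≡-mod-* (≡-mod-refl {a = ω j}) (≡-mod-+ (≡-mod-refl {a = 1ℤ}) (≡-mod-* (≡-mod-scale P β≡B-i) (≡-mod-refl {a = H}))) ⟩
      ω j * (1ℤ + P * (B - + i) * H) ∎
      where
      open import Relation.Binary.Reasoning.Setoid (≡-mod-setoid {P²})
      β≡B-i : + β ≡ B - + i mod P
      β≡B-i = ≡-mod-trans (≡-mod-reflexive (add-sub (+ β) (+ i)))
                (≡-mod-+ (≡-mod-trans (≡-mod-sym (second ψ-coords)) (second w-coords)) (≡-mod-refl {a = - + i}))
        where add-sub : ∀ b i → b ≡ (b + i) - i
              add-sub = solve-∀

    coords-∈X : ∀ {w A B} → Coords w A B → w ∈ Xi p r i → InX A B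
    coords-∈X {w} {A} {B} w-coords w∈X = from-ψ (∈X⇒ w w∈X)
      where
      from-ψ : ∃[ j ] ∃[ β ] (j < q × β < p × ψ j β ≡ w) → InX A B
      from-ψ (j , β , j<q , _ , refl) = inX j j<q (coords-ψ⇒InX {j} {β} (coords-ψ j β) w-coords)

    InX⇒≡ω : ∀ {A B} (x : InX A B) → A ≡ ω (InX.row x) mod P
    InX⇒≡ω {A} {B} (inX j _ A≡) =
      ≡-mod-trans (≡-mod-P²⇒P A≡) (≡-mod-multiple (ω j * (B - + i) * H) (expand (ω j) (B - + i) H P))
      where expand : ∀ t b h x → t * (1ℤ + x * b * h) ≡ t + (t * b * h) * x
            expand = solve-∀

    InX⇒¬P∣ : ∀ {A B} → InX A B → ¬ (P ∣ A)
    InX⇒¬P∣ x@(inX j j<q _) P∣A = ¬P∣ω j j<q (≡-mod-∣ (InX⇒≡ω x) P∣A)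

    coords-InX⇒∈X : ∀ {w A B} → Valid p w → Coords w A B → InX A B → w ∈ Xi p r i
    coords-InX⇒∈X {w} {A} {B} w-valid w-coords (inX j j<q A≡) = subst (_∈ Xi p r i) ψ≡w (ψ∈X j β j<q (n%ℕd<d (B - + i) p))
      where
      β = (B - + i) %ℕ p
      β≡B-i : + β ≡ B - + i mod P
      β≡B-i = %ℕ-≡-mod (B - + i) p
      ψ≡w : ψ j β ≡ w
      ψ≡w = coords-injective (mul-valid (x₀ (τ j) β) (pow p (gy p) i)) w-valid
        (coords-cong (coords-ψ j β)
          (≡-mod-* (≡-mod-refl {a = ω j}) (≡-mod-+ (≡-mod-refl {a = 1ℤ}) (≡-mod-* (≡-mod-scale P β≡B-i) (≡-mod-refl {a = H}))))
          (≡-mod-trans (≡-mod-+ β≡B-i (≡-mod-refl {a = + i})) (≡-mod-reflexive (sub-add B (+ i)))))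
        (coords-cong w-coords A≡ ≡-mod-refl)
        where sub-add : ∀ b i → b - i + i ≡ b
              sub-add = solve-∀

module RowAnalysis where

  open import Data.Nat.Base as ℕ using (ℕ; NonZero; _<_)
  open import Data.Nat.Divisibility as ℕ using ()
  open import Data.Nat.Primality using (Prime)
  open import Data.Integer.Base hiding (NonZero; _<_)
  open import Data.Integer.Divisibility.Signed
  open import Data.Integer.Tactic.RingSolver using (solve-∀)
  open import Data.Product.Base using (_,_; proj₁)
  open import Relation.Binary.PropositionalEquality
  open import Relation.Nullary using (¬_; contradiction)
  open import Defs
  open Congruence
  open GroupArithmetic
  open Teichmuller
  open XSet

  module RowAnalysis (p : ℕ) .{{_ : NonZero p}} (p-prime : Prime p) (p-odd : ¬ (2 ℕ.∣ p))
                     (r : ℕ) (r-primitive : IsPrimitiveRootModp² p r) (i : ℕ) (C D : ℤ) where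

    open Arithmetic p
    open Teichmuller.Teichmuller p p-prime p-odd r r-primitive
    open XSet.XSet p p-prime p-odd r r-primitive i

    AX : ℕ → ℕ → ℤ
    AX j β = C + ω j * (1ℤ + P * + β * H) * (1ℤ + D * P)

    BX : ℕ → ℤ
    BX β = D + (+ β + + i)

    ActiveRow : ℕ → Set
    ActiveRow j = C + P * ω j * D * (1ℤ - H) ≡ 0ℤ mod P²

    private
      P∣difference⇒≡ : ∀ {m n} → m < p → n < p → P ∣ + m - + n → m ≡ n
      P∣difference⇒≡ m<p n<p P∣m-n = ≡-mod⇒≡ m<p n<p (≡-mod P∣m-n)

      P²∣P*⇒P∣ : ∀ {x} → P² ∣ P * x → P ∣ x
      P²∣P*⇒P∣ = *-cancelˡ-∣ P

    AX≡C+ω : ∀ j β → AX j β ≡ C + ω j mod P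
    AX≡C+ω j β = ≡-mod-multiple (ω j * + β * H + ω j * D + ω j * + β * H * D * P) (expand C (ω j) (+ β) H D P)
      where expand : ∀ c t b h d x → c + t * (1ℤ + x * b * h) * (1ℤ + d * x)
                                     ≡ (c + t) + (t * b * h + t * d + t * b * h * d * x) * x
            expand = solve-∀

    X-row-X-hit : ∀ j β (x : InX (AX j β) (BX β)) → C + ω j ≡ ω (InX.row x) mod P
    X-row-X-hit j β x = ≡-mod-trans (≡-mod-sym (AX≡C+ω j β)) (InX⇒≡ω x)

    X-row-X-hits-unique : ∀ j β₁ β₂ → ¬ (P ∣ C) → β₁ < p → β₂ < p →
                          InX (AX j β₁) (BX β₁) → InX (AX j β₂) (BX β₂) → β₁ ≡ β₂
    X-row-X-hits-unique j β₁ β₂ P∤C β₁<p β₂<p x₁@(inX j₁ j₁<q e₁) x₂@(inX j₂ j₂<q e₂) =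
      P∣difference⇒≡ β₁<p β₂<p (P∣abc⇒P∣c (ω j - ω j₁) H (+ β₁ - + β₂) P∣product P∤ωj-ωj₁ ¬P∣H)
      where
      j₁≡j₂ : j₁ ≡ j₂
      j₁≡j₂ = ω-injective j₁ j₂ j₁<q j₂<q (≡-mod-trans (≡-mod-sym (X-row-X-hit j β₁ x₁)) (X-row-X-hit j β₂ x₂))
      e₂′ : AX j β₂ ≡ ω j₁ * (1ℤ + P * (BX β₂ - + i) * H) mod P²
      e₂′ = subst (λ k → AX j β₂ ≡ ω k * (1ℤ + P * (BX β₂ - + i) * H) mod P²) (sym j₁≡j₂) e₂
      P∤ωj-ωj₁ : ¬ (P ∣ ω j - ω j₁)
      P∤ωj-ωj₁ P∣ωj-ωj₁ = P∤C (∣-lincomb₂ C 1ℤ (- 1ℤ) (∣-difference (X-row-X-hit j β₁ x₁)) P∣ωj-ωj₁ (identity C (ω j) (ω j₁)))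
        where identity : ∀ c t t′ → c ≡ 1ℤ * (c + t - t′) + (- 1ℤ) * (t - t′)
              identity = solve-∀
      P∣product : P ∣ (ω j - ω j₁) * H * (+ β₁ - + β₂)
      P∣product = P²∣P*⇒P∣ (∣-lincomb₃ (P * ((ω j - ω j₁) * H * (+ β₁ - + β₂))) 1ℤ (- 1ℤ) (- (ω j * H * (+ β₁ - + β₂) * D))
                    (∣-difference e₁) (∣-difference e₂′) ∣-refl (identity C D (ω j) (ω j₁) (+ β₁) (+ β₂) (+ i) H P))
        where identity : ∀ c d t t′ b₁ b₂ i h x →
                         x * ((t - t′) * h * (b₁ - b₂))
                           ≡ 1ℤ * ((c + t * (1ℤ + x * b₁ * h) * (1ℤ + d * x)) - t′ * (1ℤ + x * ((d + (b₁ + i)) - i) * h))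
                             + (- 1ℤ) * ((c + t * (1ℤ + x * b₂ * h) * (1ℤ + d * x)) - t′ * (1ℤ + x * ((d + (b₂ + i)) - i) * h))
                             + (- (t * h * (b₁ - b₂) * d)) * (x * x)
              identity = solve-∀

    X-row-P²∣-unique : ∀ j β₁ β₂ → j < q → β₁ < p → β₂ < p → P² ∣ AX j β₁ → P² ∣ AX j β₂ → β₁ ≡ β₂
    X-row-P²∣-unique j β₁ β₂ j<q β₁<p β₂<p P²∣AX₁ P²∣AX₂ =
      P∣difference⇒≡ β₁<p β₂<p (P∣abc⇒P∣c (ω j) H (+ β₁ - + β₂) P∣product (¬P∣ω j j<q) ¬P∣H)
      where
      P∣product : P ∣ ω j * H * (+ β₁ - + β₂)
      P∣product = P²∣P*⇒P∣ (∣-lincomb₃ _ 1ℤ (- 1ℤ) (- (ω j * H * (+ β₁ - + β₂) * D)) P²∣AX₁ P²∣AX₂ ∣-refl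
                    (identity C D (ω j) (+ β₁) (+ β₂) H P))
        where identity : ∀ c d t b₁ b₂ h x →
                         x * (t * h * (b₁ - b₂))
                           ≡ 1ℤ * (c + t * (1ℤ + x * b₁ * h) * (1ℤ + d * x)) + (- 1ℤ) * (c + t * (1ℤ + x * b₂ * h) * (1ℤ + d * x))
                             + (- (t * h * (b₁ - b₂) * d)) * (x * x)
              identity = solve-∀

    X-row-P∣BX-unique : ∀ β₁ β₂ → β₁ < p → β₂ < p → P ∣ BX β₁ → P ∣ BX β₂ → β₁ ≡ β₂
    X-row-P∣BX-unique β₁ β₂ β₁<p β₂<p P∣BX₁ P∣BX₂ =
      P∣difference⇒≡ β₁<p β₂<p (∣-lincomb₂ _ 1ℤ (- 1ℤ) P∣BX₁ P∣BX₂ (identity D (+ β₁) (+ β₂) (+ i)))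
      where identity : ∀ d b₁ b₂ i → b₁ - b₂ ≡ 1ℤ * (d + (b₁ + i)) + (- 1ℤ) * (d + (b₂ + i))
            identity = solve-∀

    X-row-X-hit⇒P∤AX : ∀ j β₁ β₂ → InX (AX j β₁) (BX β₁) → ¬ (P ∣ AX j β₂)
    X-row-X-hit⇒P∤AX j β₁ β₂ x@(inX j′ j′<q _) P∣AX₂ =
      ¬P∣ω j′ j′<q (≡-mod-∣ (X-row-X-hit j β₁ x) (≡-mod-∣ (AX≡C+ω j β₂) P∣AX₂))

    P∣C⇒P∤AX : ∀ j β → j < q → P ∣ C → ¬ (P ∣ AX j β)
    P∣C⇒P∤AX j β j<q P∣C P∣AX =
      ¬P∣ω j j<q (∣-lincomb₂ (ω j) 1ℤ (- 1ℤ) (≡-mod-∣ (AX≡C+ω j β) P∣AX) P∣C (identity C (ω j)))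
      where identity : ∀ c t → t ≡ 1ℤ * (c + t) + (- 1ℤ) * c
            identity = solve-∀

    P∣C⇒active : ∀ j β → j < q → P ∣ C → InX (AX j β) (BX β) → ActiveRow j
    P∣C⇒active j β j<q P∣C x@(inX j′ j′<q e) =
      ∣⇒≡0-mod (∣-lincomb₂ (C + P * ω j * D * (1ℤ - H)) 1ℤ (- (ω j * + β * H * D)) (∣-difference e′) ∣-refl
        (identity C D (ω j) (+ β) (+ i) H P))
      where
      ωj≡C+ωj : ω j ≡ C + ω j mod P
      ωj≡C+ωj = ≡-mod (subst (P ∣_) (identity C (ω j)) (∣m⇒∣-m P∣C))
        where identity : ∀ c t → - c ≡ t - (c + t)
              identity = solve-∀
      j≡j′ : j ≡ j′
      j≡j′ = ω-injective j j′ j<q j′<q (≡-mod-trans ωj≡C+ωj (X-row-X-hit j β x))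
      e′ : AX j β ≡ ω j * (1ℤ + P * (BX β - + i) * H) mod P²
      e′ = subst (λ k → AX j β ≡ ω k * (1ℤ + P * (BX β - + i) * H) mod P²) (sym j≡j′) e
      identity : ∀ c d t b i h x →
                 c + x * t * d * (1ℤ - h)
                   ≡ 1ℤ * ((c + t * (1ℤ + x * b * h) * (1ℤ + d * x)) - t * (1ℤ + x * ((d + (b + i)) - i) * h))
                     + (- (t * b * h * d)) * (x * x)
      identity = solve-∀

    Y-row-X-hits-unique : ∀ b₁ b₂ → b₁ < p → b₂ < p → InX C (D + + b₁) → InX C (D + + b₂) → b₁ ≡ b₂
    Y-row-X-hits-unique b₁ b₂ b₁<p b₂<p x₁@(inX j₁ j₁<q e₁) x₂@(inX j₂ j₂<q e₂) =
      P∣difference⇒≡ b₁<p b₂<p (P∣abc⇒P∣c (ω j₁) H (+ b₁ - + b₂) P∣product (¬P∣ω j₁ j₁<q) ¬P∣H)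
      where
      j₁≡j₂ : j₁ ≡ j₂
      j₁≡j₂ = ω-injective j₁ j₂ j₁<q j₂<q (≡-mod-trans (≡-mod-sym (InX⇒≡ω x₁)) (InX⇒≡ω x₂))
      e₂′ : C ≡ ω j₁ * (1ℤ + P * ((D + + b₂) - + i) * H) mod P²
      e₂′ = subst (λ k → C ≡ ω k * (1ℤ + P * ((D + + b₂) - + i) * H) mod P²) (sym j₁≡j₂) e₂
      P∣product : P ∣ ω j₁ * H * (+ b₁ - + b₂)
      P∣product = P²∣P*⇒P∣ (∣-lincomb₂ (P * (ω j₁ * H * (+ b₁ - + b₂))) (- 1ℤ) 1ℤ (∣-difference e₁) (∣-difference e₂′)
                    (identity C D (ω j₁) (+ b₁) (+ b₂) (+ i) H P))
        where identity : ∀ c d t b₁ b₂ i h x →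
                         x * (t * h * (b₁ - b₂))
                           ≡ (- 1ℤ) * (c - t * (1ℤ + x * ((d + b₁) - i) * h)) + 1ℤ * (c - t * (1ℤ + x * ((d + b₂) - i) * h))
              identity = solve-∀

    Z-row-X-hits-unique : ∀ k₁ k₂ → k₁ < p → k₂ < p → InX (C + + k₁ * P) D → InX (C + + k₂ * P) D → k₁ ≡ k₂
    Z-row-X-hits-unique k₁ k₂ k₁<p k₂<p x₁@(inX j₁ j₁<q e₁) x₂@(inX j₂ j₂<q e₂) =
      P∣difference⇒≡ k₁<p k₂<p (P²∣P*⇒P∣ (∣-lincomb₂ (P * (+ k₁ - + k₂)) 1ℤ (- 1ℤ) (∣-difference e₁) (∣-difference e₂′)
        (identity C D (ω j₁) (+ k₁) (+ k₂) (+ i) H P)))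
      where
      C+kP≡C : ∀ k → C + + k * P ≡ C mod P
      C+kP≡C k = ≡-mod-multiple (+ k) refl
      j₁≡j₂ : j₁ ≡ j₂
      j₁≡j₂ = ω-injective j₁ j₂ j₁<q j₂<q
        (≡-mod-trans (≡-mod-sym (InX⇒≡ω x₁)) (≡-mod-trans (C+kP≡C k₁) (≡-mod-trans (≡-mod-sym (C+kP≡C k₂)) (InX⇒≡ω x₂))))
      e₂′ : C + + k₂ * P ≡ ω j₁ * (1ℤ + P * (D - + i) * H) mod P²
      e₂′ = subst (λ k → C + + k₂ * P ≡ ω k * (1ℤ + P * (D - + i) * H) mod P²) (sym j₁≡j₂) e₂
      identity : ∀ c d t k₁ k₂ i h x →
                 x * (k₁ - k₂) ≡ 1ℤ * ((c + k₁ * x) - t * (1ℤ + x * (d - i) * h)) + (- 1ℤ) * ((c + k₂ * x) - t * (1ℤ + x * (d - i) * h))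
      identity = solve-∀

    active-D≡0⇒C≡0 : ∀ j → D ≡ 0ℤ → ActiveRow j → C ≡ 0ℤ mod P²
    active-D≡0⇒C≡0 j refl active = ≡-mod-trans (≡-mod-reflexive (identity C (ω j) H P)) active
      where identity : ∀ c t h x → c ≡ c + x * t * 0ℤ * (1ℤ - h)
            identity = solve-∀

    active-C≡0⇒P∣D : ∀ j → j < q → C ≡ 0ℤ → ActiveRow j → P ∣ D
    active-C≡0⇒P∣D j j<q refl active = P∣abc⇒P∣c (ω j) (1ℤ - H) D
      (P²∣P*⇒P∣ (subst (P² ∣_) (identity (ω j) D H P) (≡0-mod⇒∣ active))) (¬P∣ω j j<q) ¬P∣1-H
      where identity : ∀ t d h x → 0ℤ + x * t * d * (1ℤ - h) ≡ x * (t * (1ℤ - h) * d)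
            identity = solve-∀

    active-rows-unique : ∀ j₁ j₂ → j₁ < q → j₂ < q → ¬ (P ∣ D) → ActiveRow j₁ → ActiveRow j₂ → j₁ ≡ j₂
    active-rows-unique j₁ j₂ j₁<q j₂<q P∤D active₁ active₂ = ω-injective j₁ j₂ j₁<q j₂<q (≡-mod
      (P∣abc⇒P∣c D (1ℤ - H) (ω j₁ - ω j₂)
        (P²∣P*⇒P∣ (∣-lincomb₂ _ 1ℤ (- 1ℤ) (≡0-mod⇒∣ active₁) (≡0-mod⇒∣ active₂) (identity C (ω j₁) (ω j₂) D H P)))
        P∤D ¬P∣1-H))
      where identity : ∀ c t₁ t₂ d h x →
                       x * (d * (1ℤ - h) * (t₁ - t₂)) ≡ 1ℤ * (c + x * t₁ * d * (1ℤ - h)) + (- 1ℤ) * (c + x * t₂ * d * (1ℤ - h))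
            identity = solve-∀

module Coincidences where

  open import Data.Nat.Base as ℕ using (ℕ; NonZero; _<_; _≤_; z≤n)
  import Data.Nat.Properties as ℕ
  open import Data.Nat.Divisibility as ℕ using ()
  open import Data.Nat.Primality using (Prime)
  open import Data.Integer.Base hiding (NonZero; _<_; _≤_; ∣_∣)
  open import Data.Integer.Properties using (pos-*; +-identityʳ)
  open import Data.Integer.Divisibility.Signed
  open import Data.Integer.Tactic.RingSolver using (solve-∀)
  open import Data.Bool.Base using (T; _∨_)
  open import Data.Bool.Properties using (T-∨)
  open import Data.Product.Base using (_×_; _,_; proj₁; proj₂; ∃-syntax)
  open import Data.Sum.Base using (_⊎_; inj₁; inj₂; [_,_])
  import Data.Sum.Base
  open import Data.Empty using (⊥-elim)
  open import Function.Base using (_∘_)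
  open import Function.Bundles using (Equivalence)
  open import Relation.Binary.PropositionalEquality hiding ([_])
  open import Relation.Nullary using (¬_; contradiction; yes; no)
  open import Defs
  open FiniteSums
  open Congruence
  open GroupArithmetic
  open SumsOverG
  open Subgroups
  open Teichmuller
  open XSet
  open RowAnalysis
  open Coefficients

  module Coincidences (p : ℕ) .{{_ : NonZero p}} (p-prime : Prime p) (p-odd : ¬ (2 ℕ.∣ p))
                      (r : ℕ) (r-primitive : IsPrimitiveRootModp² p r) (i : ℕ) where

    open Arithmetic p
    open Sums p
    open Subgroups.Subgroups p
    open Teichmuller.Teichmuller p p-prime p-odd r r-primitive
    open XSet.XSet p p-prime p-odd r r-primitive i
    open Coefficients.Coefficients p

    X-Y-disjoint : ∀ v → Valid p v → ¬ (v ∈ Xi p r i × v ∈ Ysub p)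
    X-Y-disjoint v v-valid (v∈X , v∈Y) =
      InX⇒¬P∣ (coords-∈X (coords-self v) v∈X) (≡0-mod⇒∣ (≡-mod-P²⇒P (coords-∈Y v-valid (coords-self v) v∈Y)))

    X-Z-disjoint : ∀ v → Valid p v → ¬ (v ∈ Xi p r i × v ∈ Zsub p)
    X-Z-disjoint v v-valid (v∈X , v∈Z) =
      InX⇒¬P∣ (coords-∈X (coords-self v) v∈X) (proj₁ (coords-∈Z v-valid (coords-self v) v∈Z))

    q*p+1*p≡p*p : q ℕ.* p ℕ.+ 1 ℕ.* p ≡ p ℕ.* p
    q*p+1*p≡p*p = trans (sym (ℕ.*-distribʳ-+ p q 1)) (cong (ℕ._* p) (trans (ℕ.+-comm q 1) (sym p≡1+q)))

    card-Yi : card p (Yi p r i) ≡ p ℕ.* p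
    card-Yi = trans (card-∪ X-parametrisation Y-parametrisation X-Y-disjoint) q*p+1*p≡p*p

    card-Zi : card p (Zi p r i) ≡ p ℕ.* p
    card-Zi = trans (card-∪ X-parametrisation Z-parametrisation X-Z-disjoint) q*p+1*p≡p*p

    module _ (rowX : ℕ → ℕ) (rowM : ℕ) where

      rows≤p : (∀ j → j < q → rowX j ≤ 1) → rowM ≤ 1 → ∑ q rowX ℕ.+ (rowM ℕ.+ 0) ≤ p
      rows≤p rowX≤1 rowM≤1 = ℕ.≤-trans (ℕ.+-mono-≤ (∑-≤-count q rowX≤1) (ℕ.≤-trans (ℕ.≤-reflexive (ℕ.+-identityʳ rowM)) rowM≤1))
                                        (ℕ.≤-reflexive (trans (ℕ.+-comm q 1) (sym p≡1+q)))

      rows≤p-only-M : (∀ j → j < q → rowX j ≡ 0) → rowM ≤ p → ∑ q rowX ℕ.+ (rowM ℕ.+ 0) ≤ p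
      rows≤p-only-M rowX≡0 rowM≤p = subst (ℕ._≤ p) (sym (cong₂ ℕ._+_ (∑-zero q rowX≡0) (ℕ.+-identityʳ rowM))) rowM≤p

      rows≤p-one-X : (∀ j → j < q → rowX j ≤ p) → AtMostOnePositive q rowX → rowM ≡ 0 → ∑ q rowX ℕ.+ (rowM ℕ.+ 0) ≤ p
      rows≤p-one-X rowX≤p one rowM≡0 = subst (ℕ._≤ p) (sym (trans (cong (λ m → ∑ q rowX ℕ.+ (m ℕ.+ 0)) rowM≡0) (ℕ.+-identityʳ _)))
                                         (∑-≤-atMostOnePositive q rowX p rowX≤p one)

      rows≡0 : (∀ j → j < q → rowX j ≡ 0) → rowM ≡ 0 → ∑ q rowX ℕ.+ (rowM ℕ.+ 0) ≡ 0
      rows≡0 rowX≡0 rowM≡0 = cong₂ ℕ._+_ (∑-zero q rowX≡0) (cong (ℕ._+ 0) rowM≡0)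

    module Translation (c d : ℕ) (c<p² : c < p ℕ.* p) (d<p : d < p) where

      open RowAnalysis.RowAnalysis p p-prime p-odd r r-primitive i (+ c) (+ d)

      g : G p
      g = (c , d)

      coords-gψ : ∀ j β → Coords (mul p g (ψ j β)) (AX j β) (BX β)
      coords-gψ j β = coords-mul (coords-self g) (coords-ψ j β)

      coords-gy : ∀ b → Coords (mul p g (0 , b)) (+ c) (+ d + + b)
      coords-gy b = coords-cong (coords-mul (coords-self g) (coords-self (0 , b))) (≡-mod-reflexive (identity (+ c) (+ d) P)) ≡-mod-refl
        where identity : ∀ c d x → c + 0ℤ * (1ℤ + d * x) ≡ c
              identity = solve-∀

      coords-gz : ∀ k → Coords (mul p g (k ℕ.* p , 0)) (+ c + + k * P) (+ d)
      coords-gz k = coords-cong (coords-mul (coords-self g) (coords-self (k ℕ.* p , 0)))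
        (≡-mod-multiple (+ k * + d) (trans (cong (λ kp → + c + kp * (1ℤ + + d * P)) (pos-* k p)) (identity (+ c) (+ d) (+ k) P)))
        (≡-mod-reflexive (+-identityʳ (+ d)))
        where identity : ∀ c d k x → c + k * x * (1ℤ + d * x) ≡ (c + k * x) + (k * d) * (x * x)
              identity = solve-∀

      P²∣c⇒c≡0 : P² ∣ + c → c ≡ 0
      P²∣c⇒c≡0 P²∣c = ≡-mod-P²⇒≡ c<p² 0<p² (∣⇒≡0-mod P²∣c)

      P∣d⇒d≡0 : P ∣ + d → d ≡ 0
      P∣d⇒d≡0 P∣d = ≡-mod⇒≡ d<p 0<p (∣⇒≡0-mod P∣d)

      P∣[c+kP]⇒P∣c : ∀ k → P ∣ + c + + k * P → P ∣ + c
      P∣[c+kP]⇒P∣c k P∣c+kP = ∣m+n∣n⇒∣m P∣c+kP (∣n⇒∣m*n (+ k) ∣-refl)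

      hit-Yi : ∀ {w A B} → Valid p w → Coords w A B → w ∈ Yi p r i → InX A B ⊎ P² ∣ A
      hit-Yi w-valid w-coords w∈Yi =
        Data.Sum.Base.map (coords-∈X w-coords) (λ w∈Y → ≡0-mod⇒∣ (coords-∈Y w-valid w-coords w∈Y)) (Equivalence.to T-∨ w∈Yi)

      hit-Zi : ∀ {w A B} → Valid p w → Coords w A B → w ∈ Zi p r i → InX A B ⊎ (P ∣ A × P ∣ B)
      hit-Zi w-valid w-coords w∈Zi =
        Data.Sum.Base.map (coords-∈X w-coords) (coords-∈Z w-valid w-coords) (Equivalence.to T-∨ w∈Zi)

      X-row : Subset p → ℕ → ℕ
      X-row S j = ∑[ β < p ] ind p (S (mul p g (ψ j β)))

      Y-row : ℕ
      Y-row = ∑[ b < p ] ind p (Yi p r i (mul p g (0 , b)))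

      Z-row : ℕ
      Z-row = ∑[ k < p ] ind p (Zi p r i (mul p g (k ℕ.* p , 0)))

      Yi-X-row≤1 : ¬ (P ∣ + c) → ∀ j → j < q → X-row (Yi p r i) j ≤ 1
      Yi-X-row≤1 P∤c j j<q = row≤1 (Yi p r i) p (λ β → mul p g (ψ j β)) (λ β₁ β₂ β₁<p β₂<p h₁ h₂ →
        unique β₁ β₂ β₁<p β₂<p (hit-Yi (mul-valid g (ψ j β₁)) (coords-gψ j β₁) h₁) (hit-Yi (mul-valid g (ψ j β₂)) (coords-gψ j β₂) h₂))
        where
        unique : ∀ β₁ β₂ → β₁ < p → β₂ < p → InX (AX j β₁) (BX β₁) ⊎ P² ∣ AX j β₁ → InX (AX j β₂) (BX β₂) ⊎ P² ∣ AX j β₂ → β₁ ≡ β₂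
        unique β₁ β₂ β₁<p β₂<p (inj₁ x₁) (inj₁ x₂) = X-row-X-hits-unique j β₁ β₂ P∤c β₁<p β₂<p x₁ x₂
        unique β₁ β₂ β₁<p β₂<p (inj₂ a₁) (inj₂ a₂) = X-row-P²∣-unique j β₁ β₂ j<q β₁<p β₂<p a₁ a₂
        unique β₁ β₂ _ _ (inj₁ x₁) (inj₂ a₂) = ⊥-elim (X-row-X-hit⇒P∤AX j β₁ β₂ x₁ (P²∣⇒P∣ a₂))
        unique β₁ β₂ _ _ (inj₂ a₁) (inj₁ x₂) = ⊥-elim (X-row-X-hit⇒P∤AX j β₂ β₁ x₂ (P²∣⇒P∣ a₁))

      Yi-Y-row≤1 : ¬ (P ∣ + c) → Y-row ≤ 1
      Yi-Y-row≤1 P∤c = row≤1 (Yi p r i) p (λ b → mul p g (0 , b)) (λ b₁ b₂ b₁<p b₂<p h₁ h₂ →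
        unique b₁ b₂ b₁<p b₂<p (hit-Yi (mul-valid g (0 , b₁)) (coords-gy b₁) h₁) (hit-Yi (mul-valid g (0 , b₂)) (coords-gy b₂) h₂))
        where
        unique : ∀ b₁ b₂ → b₁ < p → b₂ < p → InX (+ c) (+ d + + b₁) ⊎ P² ∣ + c → InX (+ c) (+ d + + b₂) ⊎ P² ∣ + c → b₁ ≡ b₂
        unique b₁ b₂ b₁<p b₂<p (inj₁ x₁) (inj₁ x₂) = Y-row-X-hits-unique b₁ b₂ b₁<p b₂<p x₁ x₂
        unique _ _ _ _ (inj₂ a) _ = ⊥-elim (P∤c (P²∣⇒P∣ a))
        unique _ _ _ _ _ (inj₂ a) = ⊥-elim (P∤c (P²∣⇒P∣ a))

      Yi-X-hit⇒active : P ∣ + c → ∀ j β → j < q → mul p g (ψ j β) ∈ Yi p r i → ActiveRow j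
      Yi-X-hit⇒active P∣c j β j<q h =
        [ P∣C⇒active j β j<q P∣c , (λ a → ⊥-elim (P∣C⇒P∤AX j β j<q P∣c (P²∣⇒P∣ a))) ] (hit-Yi (mul-valid g (ψ j β)) (coords-gψ j β) h)

      Yi-Y-hit⇒c≡0 : P ∣ + c → ∀ b → mul p g (0 , b) ∈ Yi p r i → c ≡ 0
      Yi-Y-hit⇒c≡0 P∣c b h = [ (λ x → ⊥-elim (InX⇒¬P∣ x P∣c)) , P²∣c⇒c≡0 ] (hit-Yi (mul-valid g (0 , b)) (coords-gy b) h)

      Zi-X-row≤1 : ¬ (P ∣ + c) → ∀ j → j < q → X-row (Zi p r i) j ≤ 1
      Zi-X-row≤1 P∤c j j<q = row≤1 (Zi p r i) p (λ β → mul p g (ψ j β)) (λ β₁ β₂ β₁<p β₂<p h₁ h₂ →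
        unique β₁ β₂ β₁<p β₂<p (hit-Zi (mul-valid g (ψ j β₁)) (coords-gψ j β₁) h₁) (hit-Zi (mul-valid g (ψ j β₂)) (coords-gψ j β₂) h₂))
        where
        unique : ∀ β₁ β₂ → β₁ < p → β₂ < p → InX (AX j β₁) (BX β₁) ⊎ (P ∣ AX j β₁ × P ∣ BX β₁) →
                 InX (AX j β₂) (BX β₂) ⊎ (P ∣ AX j β₂ × P ∣ BX β₂) → β₁ ≡ β₂
        unique β₁ β₂ β₁<p β₂<p (inj₁ x₁) (inj₁ x₂) = X-row-X-hits-unique j β₁ β₂ P∤c β₁<p β₂<p x₁ x₂
        unique β₁ β₂ β₁<p β₂<p (inj₂ (_ , b₁)) (inj₂ (_ , b₂)) = X-row-P∣BX-unique β₁ β₂ β₁<p β₂<p b₁ b₂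
        unique β₁ β₂ _ _ (inj₁ x₁) (inj₂ (a₂ , _)) = ⊥-elim (X-row-X-hit⇒P∤AX j β₁ β₂ x₁ a₂)
        unique β₁ β₂ _ _ (inj₂ (a₁ , _)) (inj₁ x₂) = ⊥-elim (X-row-X-hit⇒P∤AX j β₂ β₁ x₂ a₁)

      Zi-Z-row≤1 : ¬ (P ∣ + c) → Z-row ≤ 1
      Zi-Z-row≤1 P∤c = row≤1 (Zi p r i) p (λ k → mul p g (k ℕ.* p , 0)) (λ k₁ k₂ k₁<p k₂<p h₁ h₂ →
        unique k₁ k₂ k₁<p k₂<p (hit-Zi (mul-valid g (k₁ ℕ.* p , 0)) (coords-gz k₁) h₁) (hit-Zi (mul-valid g (k₂ ℕ.* p , 0)) (coords-gz k₂) h₂))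
        where
        unique : ∀ k₁ k₂ → k₁ < p → k₂ < p → InX (+ c + + k₁ * P) (+ d) ⊎ (P ∣ + c + + k₁ * P × P ∣ + d) →
                 InX (+ c + + k₂ * P) (+ d) ⊎ (P ∣ + c + + k₂ * P × P ∣ + d) → k₁ ≡ k₂
        unique k₁ k₂ k₁<p k₂<p (inj₁ x₁) (inj₁ x₂) = Z-row-X-hits-unique k₁ k₂ k₁<p k₂<p x₁ x₂
        unique k₁ _ _ _ (inj₂ (a , _)) _ = ⊥-elim (P∤c (P∣[c+kP]⇒P∣c k₁ a))
        unique _ k₂ _ _ _ (inj₂ (a , _)) = ⊥-elim (P∤c (P∣[c+kP]⇒P∣c k₂ a))

      Zi-X-hit⇒active : P ∣ + c → ∀ j β → j < q → mul p g (ψ j β) ∈ Zi p r i → ActiveRow j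
      Zi-X-hit⇒active P∣c j β j<q h =
        [ P∣C⇒active j β j<q P∣c , (λ hit → ⊥-elim (P∣C⇒P∤AX j β j<q P∣c (proj₁ hit))) ] (hit-Zi (mul-valid g (ψ j β)) (coords-gψ j β) h)

      Zi-Z-hit⇒d≡0 : P ∣ + c → ∀ k → mul p g (k ℕ.* p , 0) ∈ Zi p r i → d ≡ 0
      Zi-Z-hit⇒d≡0 P∣c k h = [ (λ x → ⊥-elim (InX⇒¬P∣ x (∣m∣n⇒∣m+n P∣c (∣n⇒∣m*n (+ k) ∣-refl)))) , (λ hit → P∣d⇒d≡0 (proj₂ hit)) ]
        (hit-Zi (mul-valid g (k ℕ.* p , 0)) (coords-gz k) h)

      Yi-decomposition : coincidences (Yi p r i) g ≡ ∑ q (X-row (Yi p r i)) ℕ.+ (Y-row ℕ.+ 0)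
      Yi-decomposition = ΣG-∪ X-parametrisation Y-parametrisation X-Y-disjoint (λ v → ind p (Yi p r i (mul p g v)))

      Yi-X-rows≡0 : P ∣ + c → (∀ j → j < q → ¬ ActiveRow j) → ∀ j → j < q → X-row (Yi p r i) j ≡ 0
      Yi-X-rows≡0 P∣c inactive j j<q =
        row≡0 (Yi p r i) p (λ β → mul p g (ψ j β)) (λ β _ h → inactive j j<q (Yi-X-hit⇒active P∣c j β j<q h))

      Yi-coincidences-in-Z : g ≢ e p → g ∈ Zsub p → coincidences (Yi p r i) g ≡ 0
      Yi-coincidences-in-Z g≢e g∈Z = trans Yi-decomposition (rows≡0 _ _
        (Yi-X-rows≡0 P∣c (λ j j<q active → c≢0 (≡-mod-P²⇒≡ c<p² 0<p² (active-D≡0⇒C≡0 j (cong +_ d≡0) active))))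
        (row≡0 (Yi p r i) p (λ b → mul p g (0 , b)) (λ b _ h → c≢0 (Yi-Y-hit⇒c≡0 P∣c b h))))
        where
        d≡0 = proj₁ (∈Z⇒ g (c<p² , d<p) g∈Z)
        P∣c = proj₂ (∈Z⇒ g (c<p² , d<p) g∈Z)
        c≢0 : c ≢ 0
        c≢0 c≡0 = g≢e (cong₂ _,_ c≡0 d≡0)

      Yi-coincidences-off-Z : ¬ (g ∈ Zsub p) → coincidences (Yi p r i) g ≤ p
      Yi-coincidences-off-Z g∉Z = subst (_≤ p) (sym Yi-decomposition) bound
        where
        bound : ∑ q (X-row (Yi p r i)) ℕ.+ (Y-row ℕ.+ 0) ≤ p
        bound with P ∣? + c
        ... | no P∤c = rows≤p _ _ (Yi-X-row≤1 P∤c) (Yi-Y-row≤1 P∤c)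
        ... | yes P∣c with c ℕ.≟ 0
        ...   | yes c≡0 = rows≤p-only-M _ _
                  (Yi-X-rows≡0 P∣c (λ j j<q active → d≢0 (P∣d⇒d≡0 (active-C≡0⇒P∣D j j<q (cong +_ c≡0) active))))
                  (row≤n (Yi p r i) p (λ b → mul p g (0 , b)))
          where d≢0 : d ≢ 0
                d≢0 d≡0 = g∉Z (subst (λ d → (c , d) ∈ Zsub p) (sym d≡0) (∣⇒∈Z c c<p² P∣c))
        ...   | no c≢0 = rows≤p-one-X _ _ (λ j _ → row≤n (Yi p r i) p (λ β → mul p g (ψ j β)))
                  (λ j₁ j₂ j₁<q j₂<q pos₁ pos₂ → active-rows-unique j₁ j₂ j₁<q j₂<q P∤d (active j₁ j₁<q pos₁) (active j₂ j₂<q pos₂))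
                  (row≡0 (Yi p r i) p (λ b → mul p g (0 , b)) (λ b _ h → c≢0 (Yi-Y-hit⇒c≡0 P∣c b h)))
          where
          P∤d : ¬ (P ∣ + d)
          P∤d P∣d = g∉Z (subst (λ d → (c , d) ∈ Zsub p) (sym (P∣d⇒d≡0 P∣d)) (∣⇒∈Z c c<p² P∣c))
          active : ∀ j → j < q → 0 ℕ.< X-row (Yi p r i) j → ActiveRow j
          active j j<q pos with row-pos⇒∈ (Yi p r i) p (λ β → mul p g (ψ j β)) pos
          ... | β , _ , h = Yi-X-hit⇒active P∣c j β j<q h

      Zi-decomposition : coincidences (Zi p r i) g ≡ ∑ q (X-row (Zi p r i)) ℕ.+ (Z-row ℕ.+ 0)
      Zi-decomposition = ΣG-∪ X-parametrisation Z-parametrisation X-Z-disjoint (λ v → ind p (Zi p r i (mul p g v)))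

      Zi-X-rows≡0 : P ∣ + c → (∀ j → j < q → ¬ ActiveRow j) → ∀ j → j < q → X-row (Zi p r i) j ≡ 0
      Zi-X-rows≡0 P∣c inactive j j<q =
        row≡0 (Zi p r i) p (λ β → mul p g (ψ j β)) (λ β _ h → inactive j j<q (Zi-X-hit⇒active P∣c j β j<q h))

      Zi-coincidences-in-Y : g ≢ e p → g ∈ Ysub p → coincidences (Zi p r i) g ≡ 0
      Zi-coincidences-in-Y g≢e g∈Y = trans Zi-decomposition (rows≡0 _ _
        (Zi-X-rows≡0 P∣c (λ j j<q active → d≢0 (P∣d⇒d≡0 (active-C≡0⇒P∣D j j<q (cong +_ c≡0) active))))
        (row≡0 (Zi p r i) p (λ k → mul p g (k ℕ.* p , 0)) (λ k _ h → d≢0 (Zi-Z-hit⇒d≡0 P∣c k h))))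
        where
        c≡0 = ∈Y⇒first≡0 g (c<p² , d<p) g∈Y
        P∣c : P ∣ + c
        P∣c = subst (λ c → P ∣ + c) (sym c≡0) (∣n⇒∣m*n 0ℤ ∣-refl)
        d≢0 : d ≢ 0
        d≢0 d≡0 = g≢e (cong₂ _,_ c≡0 d≡0)

      Zi-coincidences-off-Y : ¬ (g ∈ Ysub p) → coincidences (Zi p r i) g ≤ p
      Zi-coincidences-off-Y g∉Y = subst (_≤ p) (sym Zi-decomposition) bound
        where
        c≢0 : c ≢ 0
        c≢0 c≡0 = g∉Y (subst (λ c → (c , d) ∈ Ysub p) (sym c≡0) (∈Y d d<p))
        bound : ∑ q (X-row (Zi p r i)) ℕ.+ (Z-row ℕ.+ 0) ≤ p
        bound with P ∣? + c
        ... | no P∤c = rows≤p _ _ (Zi-X-row≤1 P∤c) (Zi-Z-row≤1 P∤c)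
        ... | yes P∣c with d ℕ.≟ 0
        ...   | yes d≡0 = rows≤p-only-M _ _
                  (Zi-X-rows≡0 P∣c (λ j j<q active → c≢0 (≡-mod-P²⇒≡ c<p² 0<p² (active-D≡0⇒C≡0 j (cong +_ d≡0) active))))
                  (row≤n (Zi p r i) p (λ k → mul p g (k ℕ.* p , 0)))
        ...   | no d≢0 = rows≤p-one-X _ _ (λ j _ → row≤n (Zi p r i) p (λ β → mul p g (ψ j β)))
                  (λ j₁ j₂ j₁<q j₂<q pos₁ pos₂ → active-rows-unique j₁ j₂ j₁<q j₂<q (d≢0 ∘ P∣d⇒d≡0) (active j₁ j₁<q pos₁) (active j₂ j₂<q pos₂))
                  (row≡0 (Zi p r i) p (λ k → mul p g (k ℕ.* p , 0)) (λ k _ h → d≢0 (Zi-Z-hit⇒d≡0 P∣c k h)))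
          where
          active : ∀ j → j < q → 0 ℕ.< X-row (Zi p r i) j → ActiveRow j
          active j j<q pos with row-pos⇒∈ (Zi p r i) p (λ β → mul p g (ψ j β)) pos
          ... | β , _ , h = Zi-X-hit⇒active P∣c j β j<q h

    Yi-rds : IsRDS p (Yi p r i) (Zsub p) (p ℕ.* p) p (p ℕ.* p) p
    Yi-rds = rds-by-counting (Yi p r i) (Zsub p) card-Yi card-Z bound
      where
      bound : ∀ g → Valid p g → coincidences (Yi p r i) g ≤ target (Zsub p) g
      bound (c , d) (c<p² , d<p) = ≤target (Zsub p) (c , d)
        (λ _ → ℕ.≤-trans (coincidences≤card (Yi p r i) (c , d)) (ℕ.≤-reflexive card-Yi))
        Yi-coincidences-in-Z (λ _ → Yi-coincidences-off-Z)
        where open Translation c d c<p² d<p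

    Zi-rds : IsRDS p (Zi p r i) (Ysub p) (p ℕ.* p) p (p ℕ.* p) p
    Zi-rds = rds-by-counting (Zi p r i) (Ysub p) card-Zi card-Y bound
      where
      bound : ∀ g → Valid p g → coincidences (Zi p r i) g ≤ target (Ysub p) g
      bound (c , d) (c<p² , d<p) = ≤target (Ysub p) (c , d)
        (λ _ → ℕ.≤-trans (coincidences≤card (Zi p r i) (c , d)) (ℕ.≤-reflexive card-Zi))
        Zi-coincidences-in-Y (λ _ → Zi-coincidences-off-Y)
        where open Translation c d c<p² d<p

module Reversibility where

  open import Data.Nat.Base as ℕ using (ℕ; NonZero; _<_)
  open import Data.Nat.Divisibility as ℕ using ()
  open import Data.Nat.Primality using (Prime)
  open import Data.Integer.Base hiding (NonZero; _<_; ∣_∣)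
  open import Data.Integer.Properties using (neg-distribˡ-*)
  open import Data.Integer.Divisibility.Signed
  open import Data.Integer.Tactic.RingSolver using (solve-∀)
  open import Data.Bool.Base using (Bool; true; false; T; _∨_)
  open import Data.Bool.Properties using (T-∨)
  open import Data.Product.Base using (_×_; _,_; proj₁; proj₂; ∃-syntax)
  open import Data.Sum.Base using (_⊎_; inj₁; inj₂; [_,_])
  import Data.Sum.Base as Sum
  open import Function.Bundles using (Equivalence)
  open import Relation.Binary.PropositionalEquality hiding ([_])
  open import Relation.Nullary using (¬_)
  open import Defs
  open Congruence
  open GroupArithmetic
  open SumsOverG
  open Subgroups
  open Teichmuller
  open XSet

  module Reversibility (p : ℕ) .{{_ : NonZero p}} (p-prime : Prime p) (p-odd : ¬ (2 ℕ.∣ p))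
                       (r : ℕ) (r-primitive : IsPrimitiveRootModp² p r) (i : ℕ) where

    open Arithmetic p
    open Sums p
    open Subgroups.Subgroups p
    open Teichmuller.Teichmuller p p-prime p-odd r r-primitive
    open XSet.XSet p p-prime p-odd r r-primitive i

    reversible : ∀ S → (∀ w → Valid p w → w ∈ S → inv p w ∈ S) → Reversible p S
    reversible S closed g g-valid = T-ext (closed g g-valid)
      (λ g⁻¹∈S → subst (_∈ S) (inv-involutive g g-valid) (closed (inv p g) (inv-valid g) g⁻¹∈S))

    inv-∈Y : ∀ w → Valid p w → w ∈ Ysub p → inv p w ∈ Ysub p
    inv-∈Y w w-valid w∈Y = coords-∈Y⁻ (inv-valid w) (coords-inv w-valid (coords-self w))
      (≡-mod-* (≡-mod-neg (coords-∈Y w-valid (coords-self w) w∈Y)) (≡-mod-refl {a = 1ℤ - + proj₂ w * P}))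

    inv-∈Z : ∀ w → Valid p w → w ∈ Zsub p → inv p w ∈ Zsub p
    inv-∈Z w w-valid w∈Z = coords-∈Z⁻ (inv-valid w) (coords-inv w-valid (coords-self w))
      (∣m⇒∣m*n (1ℤ - + proj₂ w * P) (∣m⇒∣-m (proj₁ P∣A×P∣B))) (∣m⇒∣-m (proj₂ P∣A×P∣B))
      where P∣A×P∣B = coords-∈Z w-valid (coords-self w) w∈Z

    inv-∈X : ∀ w → Valid p w → w ∈ Xi p r i → inv p w ∈ Xi p r i
    inv-∈X w w-valid w∈X = from-ψ (∈X⇒ w w∈X)
      where
      from-ψ : ∃[ j ] ∃[ β ] (j < q × β < p × ψ j β ≡ w) → inv p w ∈ Xi p r i
      from-ψ (j , β , j<q , _ , refl) with ω-neg j j<q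
      ... | j′ , j′<q , ωj′≡-ωj = coords-InX⇒∈X (inv-valid (ψ j β)) (coords-inv w-valid (coords-ψ j β)) (inX j′ j′<q
        (≡-mod (∣-lincomb₃ _ (- (1ℤ + P * (- (+ β + + i) - + i) * H)) (- (ω j * (+ β + + i))) (ω j * + β * H * (+ β + + i))
          (∣-difference ωj′≡-ωj) (*-monoʳ-∣ P (∣-difference 2H≡1)) ∣-refl (identity (ω j) (ω j′) (+ β) (+ i) H P))))
        where identity : ∀ t t′ b i h x →
                         - (t * (1ℤ + x * b * h)) * (1ℤ - (b + i) * x) - t′ * (1ℤ + x * (- (b + i) - i) * h)
                           ≡ - (1ℤ + x * (- (b + i) - i) * h) * (t′ - - t) + - (t * (b + i)) * (x * (+ 2 * h - 1ℤ))
                             + t * b * h * (b + i) * (x * x)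
              identity = solve-∀

    Yi-reversible : Reversible p (Yi p r i)
    Yi-reversible = reversible (Yi p r i) (λ w w-valid w∈Yi →
      Equivalence.from T-∨ (Sum.map (inv-∈X w w-valid) (inv-∈Y w w-valid) (Equivalence.to T-∨ w∈Yi)))

    Zi-reversible : Reversible p (Zi p r i)
    Zi-reversible = reversible (Zi p r i) (λ w w-valid w∈Zi →
      Equivalence.from T-∨ (Sum.map (inv-∈X w w-valid) (inv-∈Z w w-valid) (Equivalence.to T-∨ w∈Zi)))


open import Data.Nat.Base using (ℕ; _*_; _<_; NonZero)
open import Data.Nat.Divisibility using (_∣_)
open import Data.Nat.Primality using (Prime)
open import Data.Product.Base using (_×_; _,_)
open import Relation.Nullary using (¬_)
open Coincidences
open Semiregularity
open CosetLabels
open Reversibility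

proposition7p5 : (p : ℕ) .{{_ : NonZero p}} → Prime p → ¬ (2 ∣ p) →
    (r : ℕ) → IsPrimitiveRootModp² p r →
    (i : ℕ) → i < p →
      SemiregularReversibleRDS p (Yi p r i) (Zsub p) (p * p) p (p * p) p
    × SemiregularReversibleRDS p (Zi p r i) (Ysub p) (p * p) p (p * p) p
proposition7p5 p p-prime p-odd r r-primitive i _ =
    (Yi-rds , semiregular Yi-rds Z-labelling card-Yi , Yi-reversible)
  , (Zi-rds , semiregular Zi-rds Y-labelling card-Zi , Zi-reversible)
  where
  open Coincidences.Coincidences p p-prime p-odd r r-primitive i
  open Semiregularity.Semiregularity p
  open CosetLabels.CosetLabels p
  open Reversibility.Reversibility p p-prime p-odd r r-primitive i
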